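{- Let $(T,\omega)$ and $(T',\omega')$ be strictly weighted stars such that $D_{(T,\mathsf m_\omega)}(\mathbf z)=D_{(T',\mathsf m_{\omega'})}(\mathbf z)$. Then $(T,\omega)$ and $(T',\omega')$ are $\omega$-isomorphic. (That is, a strictly weighted star can be reconstructed from its $D$-polynomial.)
   Context: A weighted tree $(T,\omega)$ has $\omega:V(T)\to\{1,2,\dots\}$; it is strictly weighted if all weights exceed $1$; it is a weighted star if $T$ is a star. $\omega$-isomorphic means isomorphic via a weight-preserving graph isomorphism. The marked version gives vertex $v$ the mark $(\omega(v),0)$; marks are pairs $(w,d)$ with $w\ge1,d\ge0,w\ge d+1$ and dot-sum $(w,d)\dotplus(w',d')=(w+w',d+d'+1)$. For a marked tree, $M_{(T,\mathsf m)}(\mathbf z)=\sum_{A\subseteq E(T)}\prod_C z_{\mathsf m(C)}$ over the connected components $C$ of $(V(T),A)$, with $\mathsf m(C)$ the dot-sum of the marks of the vertices of $C$ and $z_{w,d}$ commuting indeterminates. With $D_{\bullet_{w,d}}=\sum_{i=0}^d(-1)^i\binom di z_{w-i,0}z_{1,0}^i$, $D_{(T,\mathsf m)}(\mathbf z)$ is $M_{(T,\mathsf m)}$ with each $z_{w,d}$ replaced by $D_{\bullet_{w,d}}$. -}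

module Defs where

open import Level using (0ℓ)
open import Data.Nat using (ℕ; zero; suc; _∸_; _≤_; _<?_)
open import Data.Nat as ℕ using (_+_)
open import Data.Nat.Combinatorics using (_C_)
open import Data.Bool using (Bool; true; false; _∧_; _∨_; not; if_then_else_)
open import Data.Fin using (Fin; toℕ; _≟_)
open import Data.Fin.Properties using ()
open import Data.List using (List; []; _∷_; _++_; map; foldr; filter; length; allFin; upTo)
open import Data.Bool.ListAction using (any; all)
open import Data.List.Relation.Unary.Any using (Any)
open import Data.Product using (_×_; _,_; proj₁; proj₂; Σ; ∃)
open import Relation.Binary.PropositionalEquality using (_≡_; _≢_)
open import Relation.Nullary.Decidable using (⌊_⌋)
open import Algebra.Bundles using (CommutativeRing)
open import Function.Bundles using (_⤖_)
open import Function using (_∘_)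

Edge : ℕ → Set
Edge n = Fin n × Fin n

record Graph : Set where
  field
    size  : ℕ
    edges : List (Edge size)
open Graph public

Adj : (G : Graph) → Fin (size G) → Fin (size G) → Set
Adj G u v = Any (λ e → (proj₁ e ≡ u × proj₂ e ≡ v)) (edges G)
          ⊎' Any (λ e → (proj₁ e ≡ v × proj₂ e ≡ u)) (edges G)
  where
  open import Data.Sum renaming (_⊎_ to _⊎'_)

data Reach (G : Graph) : Fin (size G) → Fin (size G) → Set where
  here : ∀ {u} → Reach G u u
  step : ∀ {u v w} → Reach G u v → Adj G v w → Reach G u w

open import Data.List.Relation.Unary.AllPairs using (AllPairs)
open import Data.List.Relation.Unary.All using (All)

SameEdge : ∀ {n} → Edge n → Edge n → Set
SameEdge (a , b) (c , d) = (a ≡ c × b ≡ d) ⊎' (a ≡ d × b ≡ c)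
  where open import Data.Sum renaming (_⊎_ to _⊎'_)

IsSimple : Graph → Set
IsSimple G = All (λ e → proj₁ e ≢ proj₂ e) (edges G)
           × AllPairs (λ e f → SameEdge e f → ⊥') (edges G)
  where open import Data.Empty renaming (⊥ to ⊥')

IsTree : Graph → Set
IsTree G = IsSimple G × (length (edges G) + 1 ≡ size G)
         × (∀ u v → Reach G u v)

IsStar : Graph → Set
IsStar G = IsTree G × Σ (Fin (size G)) (λ c →
             All (λ e → proj₁ e ≡ c ⊎' proj₂ e ≡ c) (edges G))
  where open import Data.Sum renaming (_⊎_ to _⊎'_)

record WeightedTree : Set where
  field
    tree   : Graph
    isTree : IsTree tree
    weight : Fin (size tree) → ℕ
    weight-pos : ∀ v → 1 ≤ weight v
open WeightedTree public

StrictlyWeighted : WeightedTree → Set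
StrictlyWeighted T = ∀ v → 2 ≤ weight T v

WeightedStar : WeightedTree → Set
WeightedStar T = IsStar (tree T)

ωIsomorphic : WeightedTree → WeightedTree → Set
ωIsomorphic T T' =
  Σ (Fin (size (tree T)) ⤖ Fin (size (tree T'))) λ f →
    let φ = Bijection.to f in
    (∀ u v → (Adj (tree T) u v → Adj (tree T') (φ u) (φ v))
           × (Adj (tree T') (φ u) (φ v) → Adj (tree T) u v))
    × (∀ v → weight T' (φ v) ≡ weight T v)
  where open import Function.Bundles using (module Bijection)

Mark : Set
Mark = ℕ × ℕ

_∔_ : Mark → Mark → Mark
(w , d) ∔ (w' , d') = (w + w' , d + d' + 1)

markω : (T : WeightedTree) → Fin (size (tree T)) → Mark
markω T v = (weight T v , 0)

-- all sublists (= subsets of the edge list; edges are distinct)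
sublists : ∀ {A : Set} → List A → List (List A)
sublists []       = [] ∷ []
sublists (x ∷ xs) = let s = sublists xs in s ++ map (x ∷_) s

module Components {n : ℕ} (A : List (Edge n)) where

  eqb : Fin n → Fin n → Bool
  eqb u v = ⌊ u ≟ v ⌋

  grow : (Fin n → Bool) → (Fin n → Bool)
  grow S v = S v ∨ any (λ e → (S (proj₁ e) ∧ eqb (proj₂ e) v)
                             ∨ (S (proj₂ e) ∧ eqb (proj₁ e) v)) A

  iter : ℕ → (Fin n → Bool) → (Fin n → Bool)
  iter zero    S = S
  iter (suc k) S = iter k (grow S)

  -- the vertex set of the component containing r (n propagation steps
  -- suffice since any walk can be shortened to length < n)
  comp : Fin n → Fin n → Bool
  comp r = iter n (eqb r)

  -- r represents its component iff it is its least vertex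
  isRoot : Fin n → Bool
  isRoot r = all (λ v → not (comp r v) ∨ ⌊ toℕ r Data.Nat.≤? toℕ v ⌋) (allFin n)
    where import Data.Nat

  roots : List (Fin n)
  roots = filter (λ r → isRoot r Data.Bool.≟ true) (allFin n)
    where import Data.Bool

  compMark : (Fin n → Mark) → Fin n → Mark
  compMark m r = foldr (λ v acc → m v ∔ acc) (m r)
    (filter (λ v → (comp r v ∧ not (eqb r v)) Data.Bool.≟ true) (allFin n))
    where import Data.Bool

-- The polynomials M and D, evaluated in an arbitrary commutative ring
-- at an arbitrary assignment z of the indeterminates z_{w,d}

module Poly (R : CommutativeRing 0ℓ 0ℓ) where
  open CommutativeRing R using (Carrier; 0#; 1#; -_) renaming (_+_ to _⊕_; _*_ to _⊛_)

  sumR : List Carrier → Carrier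
  sumR = foldr _⊕_ 0#

  prodR : List Carrier → Carrier
  prodR = foldr _⊛_ 1#

  _·_ : ℕ → Carrier → Carrier
  zero  · x = 0#
  suc k · x = x ⊕ k · x

  _^_ : Carrier → ℕ → Carrier
  x ^ zero  = 1#
  x ^ suc k = x ⊛ x ^ k

  sgn : ℕ → Carrier
  sgn zero    = 1#
  sgn (suc i) = - sgn i

  -- M_{(G,m)}(z) = Σ_{A ⊆ E} Π_{components C of (V,A)} z_{m(C)}
  M : (G : Graph) → (Fin (size G) → Mark) → (ℕ → ℕ → Carrier) → Carrier
  M G m z = sumR (map (λ A → let open Components A in
                      prodR (map (λ r → let c = compMark m r in
                                         z (proj₁ c) (proj₂ c)) roots))
                  (sublists (edges G)))

  Dsub : (ℕ → ℕ → Carrier) → ℕ → ℕ → Carrier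
  Dsub z w d = sumR (map (λ i → sgn i ⊛ ((d C i) · (z (w ∸ i) 0 ⊛ (z 1 0 ^ i))))
                         (upTo (suc d)))

  D : (G : Graph) → (Fin (size G) → Mark) → (ℕ → ℕ → Carrier) → Carrier
  D G m z = M G m (Dsub z)

-- equality of D-polynomials of (marked versions of) weighted trees, as
-- elements of ℤ[z_{w,d}]: two integer polynomials are equal iff they
-- agree under every evaluation in every commutative ring
SameD : WeightedTree → WeightedTree → Set₁
SameD T T' = (R : CommutativeRing 0ℓ 0ℓ) (z : ℕ → ℕ → CommutativeRing.Carrier R) →
  CommutativeRing._≈_ R (Poly.D R (tree T) (markω T) z) (Poly.D R (tree T') (markω T') z)

{-# OPTIONS --safe #-}
module Submission where

-- Evaluate D in the dual numbers ℤ[ε]/(ε²) at z_{1,d} = 0 and z_{w,d} = 1 + ε·h(w) for w ≥ 2.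
-- Then every D_{•w,d} collapses to z_{w,0}, and since all components of a strictly weighted
-- star weigh at least 2, D becomes 2^m + ε·N(h): for each set S of spokes, the component of the
-- centre contributes h(γ + ΣS) and every leaf x outside S contributes h(x). So D determines m and
-- 2·N(h) = 2^m·Σₓ h(x) + 2·Σ_S h(γ + ΣS) for every h. Take h the indicator of k. If the centres
-- weigh the same, induction on k recovers the multiplicity of k among the leaves, because only
-- leaves lighter than k can help γ + ΣS reach k. If γ < γ', then for k = γ the empty S adds 2 on
-- one side only, which is impossible unless m = 1 (modulo 4 when m ≥ 2); for m = 1 the two stars
-- are one edge with its ends swapped.

open import Defs

open import Level using (0ℓ)
open import Algebra.Bundles using (CommutativeRing; CommutativeSemigroup)
open import Algebra.Core using (Op₂)
import Algebra.Properties.CommutativeSemigroup as CommutativeSemigroupProperties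
open import Algebra.Structures using (IsCommutativeRing; IsCommutativeMonoid)
open import Data.Bool using (Bool; true; false; if_then_else_; T; not; _∧_; _∨_)
import Data.Bool as Bool
open import Data.Bool.ListAction using (any; or)
open import Data.Bool.Properties using (T-∨; T-∧)
open import Data.Empty using (⊥-elim)
open import Data.Fin using (Fin; _≟_; toℕ; punchIn) renaming (zero to fzero; suc to fsuc)
open import Data.Fin.Permutation using (_⟨$⟩ʳ_)
import Data.Fin.Permutation as Perm
import Data.Fin.Properties as Fin
open import Data.Integer as ℤ using (ℤ; +_)
import Data.Integer.Properties as ℤ
open import Data.Integer.Tactic.RingSolver using (solve-∀)
open import Data.List using (List; []; _∷_; _++_; map; foldr; filter; allFin; tabulate; length; zipWith; applyUpTo)
open import Data.List.Membership.Propositional using (_∈_; find)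
open import Data.List.Membership.Propositional.Properties
  using (∈-allFin; ∈-map⁺; ∈-map⁻; ∈-∃++; ∈-tabulate⁻)
open import Data.List.Membership.Propositional.Properties.WithK using (unique∧set⇒bag)
open import Data.List.Properties
  using ( filter-accept; filter-reject; filter-none; length-map; length-++; map-id; map-cong; map-cong-local
        ; map-tabulate; map-∘; map-++; zipWith-map)
open import Data.List.Relation.Binary.BagAndSetEquality using (∼bag⇒↭)
open import Data.List.Relation.Binary.Permutation.Propositional using (_↭_; ↭-sym; ↭⇒↭ₛ)
import Data.List.Relation.Binary.Permutation.Propositional as ↭
open import Data.List.Relation.Binary.Permutation.Propositional.Properties
  using (map⁺; shift; drop-∷; ↭-length; ∈-resp-↭)
import Data.List.Relation.Binary.Permutation.Setoid.Properties as ↭ₛ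
open import Data.List.Relation.Unary.All using (All; []; _∷_)
import Data.List.Relation.Unary.All as All
import Data.List.Relation.Unary.All.Properties as All
open import Data.List.Relation.Unary.All.Properties using (all⁺; all⁻)
open import Data.List.Relation.Unary.AllPairs using (AllPairs; []; _∷_)
import Data.List.Relation.Unary.AllPairs.Properties as AllPairs
open import Data.List.Relation.Unary.Any using (here; there)
import Data.List.Relation.Unary.Any as Any
open import Data.List.Relation.Unary.Any.Properties using (any⁺; any⁻; Any-⊎⁺; Any-⊎⁻)
open import Data.List.Relation.Unary.Unique.Propositional using (Unique)
open import Data.List.Relation.Unary.Unique.Propositional.Properties using (allFin⁺)
open import Data.Maybe using (Maybe; just; nothing)
open import Data.Maybe.Properties using (just-injective)
open import Data.Nat using (ℕ; zero; suc; _+_; _*_; _^_; _∸_; _≡ᵇ_; _≤_; _<_; _≤?_; _<?_; z≤n; s≤s)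
open import Data.Nat.Combinatorics using (_C_)
open import Data.Nat.Induction using (<-rec)
open import Data.Nat.ListAction using (sum)
import Data.Nat.Properties as ℕ
open import Data.Nat.Properties
  using ( +-assoc; +-comm; +-identityʳ; +-cancelˡ-≡; +-cancelʳ-≡; +-mono-≤; +-0-isCommutativeMonoid
        ; *-identityʳ; *-distribˡ-+; *-cancelˡ-≡; ^-monoʳ-<; m^n≢0; even≢odd
        ; ≤-trans; ≤-reflexive; <-cmp; <⇒≢; >⇒≢; ≮⇒≥; <-irrefl; <-≤-trans; m≤m+n; m<m+n)
open import Data.Nat.Tactic.RingSolver using () renaming (solve-∀ to solve-∀ℕ)
open import Data.Product using (_×_; _,_; proj₁; proj₂; Σ; ∃; ∃₂)
import Data.Product as Product
open import Data.Sum using (_⊎_; inj₁; inj₂)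
import Data.Sum as Sum
open import Data.Vec.Functional.Relation.Binary.Permutation using () renaming (_↭_ to _↭ᵥ_)
open import Function using (_∘_; id; case_of_)
open import Function.Bundles using (_⇔_; mk⇔; Equivalence)
open import Function.Properties.Inverse using (↔⇒⤖)
open import Relation.Binary.Definitions using (tri<; tri≈; tri>)
open import Relation.Binary.PropositionalEquality
open import Relation.Nullary using (¬_; contradiction; yes; no)
open import Relation.Nullary.Decidable using (⌊_⌋; toWitness; fromWitness; T?)
open import Relation.Unary using (_⊆_)

T⇒≡true : ∀ {a} → T a → a ≡ true
T⇒≡true {true} _ = refl

¬T⇒≡false : ∀ {a} → ¬ T a → a ≡ false
¬T⇒≡false {false} _  = refl
¬T⇒≡false {true}  ¬t = contradiction _ ¬t

T-extensional : ∀ {a b} → (T a → T b) → (T b → T a) → a ≡ b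
T-extensional {false} {false} _ _ = refl
T-extensional {false} {true}  _ g = ⊥-elim (g _)
T-extensional {true}  {false} f _ = ⊥-elim (f _)
T-extensional {true}  {true}  _ _ = refl

T-implies : ∀ {a b} → T (not a ∨ b) ⇔ (T a → T b)
T-implies {false} = mk⇔ (λ _ ()) (λ _ → _)
T-implies {true}  = mk⇔ (λ b _ → b) (λ f → f _)

T-∨⁺ˡ : ∀ {a} b → T a → T (a ∨ b)
T-∨⁺ˡ {true} b _ = _

T-∨⁺ʳ : ∀ a {b} → T b → T (a ∨ b)
T-∨⁺ʳ true  _  = _
T-∨⁺ʳ false tb = tb

-- Dual numbers ℤ[ε]/(ε²)

module DualNumbers where

  infix  5 _+ε_
  infixl 6 _⊕_
  infixl 7 _⊗_

  record Dual : Set where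
    constructor _+ε_
    field
      re ep : ℤ
  open Dual public

  _⊕_ : Dual → Dual → Dual
  (a +ε b) ⊕ (c +ε d) = a ℤ.+ c +ε b ℤ.+ d

  _⊗_ : Dual → Dual → Dual
  (a +ε b) ⊗ (c +ε d) = a ℤ.* c +ε a ℤ.* d ℤ.+ b ℤ.* c

  ⊖_ : Dual → Dual
  ⊖ (a +ε b) = ℤ.- a +ε ℤ.- b

  0ᵈ 1ᵈ : Dual
  0ᵈ = + 0 +ε + 0
  1ᵈ = + 1 +ε + 0

  private
    ep-*-assoc : ∀ a b c d e f →
      (a ℤ.* c) ℤ.* f ℤ.+ (a ℤ.* d ℤ.+ b ℤ.* c) ℤ.* e ≡ a ℤ.* (c ℤ.* f ℤ.+ d ℤ.* e) ℤ.+ b ℤ.* (c ℤ.* e)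
    ep-*-assoc = solve-∀

    ep-*-identityˡ : ∀ a b → + 1 ℤ.* b ℤ.+ + 0 ℤ.* a ≡ b
    ep-*-identityˡ = solve-∀

    ep-*-identityʳ : ∀ a b → a ℤ.* + 0 ℤ.+ b ℤ.* + 1 ≡ b
    ep-*-identityʳ = solve-∀

    ep-distribˡ : ∀ a b c d e f →
      a ℤ.* (d ℤ.+ f) ℤ.+ b ℤ.* (c ℤ.+ e) ≡ (a ℤ.* d ℤ.+ b ℤ.* c) ℤ.+ (a ℤ.* f ℤ.+ b ℤ.* e)
    ep-distribˡ = solve-∀

    ep-distribʳ : ∀ a b c d e f →
      (c ℤ.+ e) ℤ.* b ℤ.+ (d ℤ.+ f) ℤ.* a ≡ (c ℤ.* b ℤ.+ d ℤ.* a) ℤ.+ (e ℤ.* b ℤ.+ f ℤ.* a)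
    ep-distribʳ = solve-∀

    ep-*-comm : ∀ a b c d → a ℤ.* d ℤ.+ b ℤ.* c ≡ c ℤ.* b ℤ.+ d ℤ.* a
    ep-*-comm = solve-∀

  dual-isCommutativeRing : IsCommutativeRing _≡_ _⊕_ _⊗_ ⊖_ 0ᵈ 1ᵈ
  dual-isCommutativeRing = record
    { isRing = record
      { +-isAbelianGroup = record
        { isGroup = record
          { isMonoid = record
            { isSemigroup = record
              { isMagma = record { isEquivalence = isEquivalence ; ∙-cong = cong₂ _⊕_ }
              ; assoc = λ { (a +ε b) (c +ε d) (e +ε f) → cong₂ _+ε_ (ℤ.+-assoc a c e) (ℤ.+-assoc b d f) } }
            ; identity = (λ { (a +ε b) → cong₂ _+ε_ (ℤ.+-identityˡ a) (ℤ.+-identityˡ b) })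
                       , (λ { (a +ε b) → cong₂ _+ε_ (ℤ.+-identityʳ a) (ℤ.+-identityʳ b) }) }
          ; inverse = (λ { (a +ε b) → cong₂ _+ε_ (ℤ.+-inverseˡ a) (ℤ.+-inverseˡ b) })
                    , (λ { (a +ε b) → cong₂ _+ε_ (ℤ.+-inverseʳ a) (ℤ.+-inverseʳ b) })
          ; ⁻¹-cong = cong ⊖_ }
        ; comm = λ { (a +ε b) (c +ε d) → cong₂ _+ε_ (ℤ.+-comm a c) (ℤ.+-comm b d) } }
      ; *-cong = cong₂ _⊗_
      ; *-assoc = λ { (a +ε b) (c +ε d) (e +ε f) → cong₂ _+ε_ (ℤ.*-assoc a c e) (ep-*-assoc a b c d e f) }
      ; *-identity = (λ { (a +ε b) → cong₂ _+ε_ (ℤ.*-identityˡ a) (ep-*-identityˡ a b) })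
                   , (λ { (a +ε b) → cong₂ _+ε_ (ℤ.*-identityʳ a) (ep-*-identityʳ a b) })
      ; distrib = (λ { (a +ε b) (c +ε d) (e +ε f) → cong₂ _+ε_ (ℤ.*-distribˡ-+ a c e) (ep-distribˡ a b c d e f) })
                , (λ { (a +ε b) (c +ε d) (e +ε f) → cong₂ _+ε_ (ℤ.*-distribʳ-+ a c e) (ep-distribʳ a b c d e f) }) }
    ; *-comm = λ { (a +ε b) (c +ε d) → cong₂ _+ε_ (ℤ.*-comm a c) (ep-*-comm a b c d) } }

  dualRing : CommutativeRing 0ℓ 0ℓ
  dualRing = record { isCommutativeRing = dual-isCommutativeRing }

  open IsCommutativeRing dual-isCommutativeRing public using ()
    renaming ( +-isCommutativeMonoid to ⊕-isCommutativeMonoid; *-isCommutativeMonoid to ⊗-isCommutativeMonoid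
             ; +-identityʳ to ⊕-identityʳ; *-identityˡ to ⊗-identityˡ; *-identityʳ to ⊗-identityʳ
             ; zeroˡ to ⊗-zeroˡ; zeroʳ to ⊗-zeroʳ)

open DualNumbers

module BigOperator {A : Set} {_∙_ : Op₂ A} {ε : A} (isCM : IsCommutativeMonoid _≡_ _∙_ ε) where

  open IsCommutativeMonoid isCM using (assoc; identityˡ; identityʳ; isCommutativeSemigroup)
  private
    commutativeSemigroup : CommutativeSemigroup 0ℓ 0ℓ
    commutativeSemigroup = record { isCommutativeSemigroup = isCommutativeSemigroup }

  open CommutativeSemigroupProperties commutativeSemigroup using (interchange)

  big : List A → A
  big = foldr _∙_ ε

  big-++ : ∀ xs ys → big (xs ++ ys) ≡ big xs ∙ big ys
  big-++ []       ys = sym (identityˡ _)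
  big-++ (x ∷ xs) ys = trans (cong (x ∙_) (big-++ xs ys)) (sym (assoc _ _ _))

  big-↭ : ∀ {xs ys} → xs ↭ ys → big xs ≡ big ys
  big-↭ p = ↭ₛ.foldr-commMonoid (setoid A) isCM (↭⇒↭ₛ p)

  module _ {X : Set} where

    big-∙ : ∀ (F G : X → A) xs → big (map (λ x → F x ∙ G x) xs) ≡ big (map F xs) ∙ big (map G xs)
    big-∙ F G []       = sym (identityˡ ε)
    big-∙ F G (x ∷ xs) = begin
      (F x ∙ G x) ∙ big (map (λ x → F x ∙ G x) xs) ≡⟨ cong (_ ∙_) (big-∙ F G xs) ⟩
      (F x ∙ G x) ∙ (big (map F xs) ∙ big (map G xs)) ≡⟨ interchange _ _ _ _ ⟩
      (F x ∙ big (map F xs)) ∙ (G x ∙ big (map G xs)) ∎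
      where open ≡-Reasoning

    big-filter : ∀ (p : X → Bool) (F : X → A) xs →
      big (map F (filter (λ x → p x Bool.≟ true) xs)) ≡ big (map (λ x → if p x then F x else ε) xs)
    big-filter p F []       = refl
    big-filter p F (x ∷ xs) with p x
    ... | true  = cong (F x ∙_) (big-filter p F xs)
    ... | false = trans (big-filter p F xs) (sym (identityˡ _))

  big-≡ε : ∀ {xs} → All (_≡ ε) xs → big xs ≡ ε
  big-≡ε []            = refl
  big-≡ε (refl ∷ x≡ε) = trans (cong (ε ∙_) (big-≡ε x≡ε)) (identityˡ ε)

  big-tabulate-unique : ∀ {n} (b : Fin n → Bool) (F : Fin n → A) {r} → T (b r) → (∀ {s} → T (b s) → s ≡ r) →
    big (tabulate (λ s → if b s then F s else ε)) ≡ F r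
  big-tabulate-unique {suc n} b F {fzero} br uniq =
    trans (cong₂ _∙_ (cong (if_then F fzero else ε) (T⇒≡true br)) (big-≡ε (All.tabulate⁺ off))) (identityʳ _)
    where
    off : ∀ s → (if b (fsuc s) then F (fsuc s) else ε) ≡ ε
    off s with T? (b (fsuc s))
    ... | yes bs = contradiction (uniq bs) λ ()
    ... | no ¬bs rewrite ¬T⇒≡false ¬bs = refl
  big-tabulate-unique {suc n} b F {fsuc r} br uniq with T? (b fzero)
  ... | yes b0 = contradiction (uniq b0) λ ()
  ... | no ¬b0 rewrite ¬T⇒≡false ¬b0 =
    trans (identityˡ _) (big-tabulate-unique (b ∘ fsuc) (F ∘ fsuc) br (Fin.suc-injective ∘ uniq))

  big-unique : ∀ {n} (b : Fin n → Bool) (F : Fin n → A) {r} → T (b r) → (∀ {s} → T (b s) → s ≡ r) →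
    big (map (λ s → if b s then F s else ε) (allFin n)) ≡ F r
  big-unique b F br uniq = trans (cong big (map-tabulate id (λ s → if b s then F s else ε))) (big-tabulate-unique b F br uniq)

module NatSum = BigOperator +-0-isCommutativeMonoid
module DualSum = BigOperator ⊕-isCommutativeMonoid
module DualProduct = BigOperator ⊗-isCommutativeMonoid

open CommutativeSemigroupProperties ℕ.+-commutativeSemigroup using ()
  renaming (interchange to +-interchange; x∙yz≈y∙xz to +-exchange)

Joins : ∀ {n} → Edge n → Fin n → Fin n → Set
Joins e u v = (proj₁ e ≡ u × proj₂ e ≡ v) ⊎ (proj₁ e ≡ v × proj₂ e ≡ u)

Joins-sym : ∀ {n} {e : Edge n} {u v} → Joins e u v → Joins e v u
Joins-sym = Sum.swap

module Growth {n : ℕ} (A : List (Edge n)) where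

  open Components A

  crossing : (Fin n → Bool) → Fin n → Edge n → Bool
  crossing S v e = (S (proj₁ e) ∧ eqb (proj₂ e) v) ∨ (S (proj₂ e) ∧ eqb (proj₁ e) v)

  grow-inflationary : ∀ S {v} → T (S v) → T (grow S v)
  grow-inflationary S sv = T-∨⁺ˡ _ sv

  grow⁺ : ∀ S {e u v} → e ∈ A → Joins e u v → T (S u) → T (grow S v)
  grow⁺ S {v = v} e∈A joins su =
    T-∨⁺ʳ _ (any⁺ (crossing S v) (Any.map (λ { refl → crosses joins }) e∈A))
    where
    crosses : ∀ {e} → Joins e _ v → T (crossing S v e)
    crosses (inj₁ (refl , refl)) = T-∨⁺ˡ _ (Equivalence.from T-∧ (su , fromWitness refl))
    crosses (inj₂ (refl , refl)) = T-∨⁺ʳ _ (Equivalence.from T-∧ (su , fromWitness refl))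

  grow⁻ : ∀ S {v} → T (grow S v) → T (S v) ⊎ ∃₂ λ e u → e ∈ A × Joins e u v × T (S u)
  grow⁻ S {v} g with Equivalence.to T-∨ g
  ... | inj₁ sv = inj₁ sv
  ... | inj₂ crosses with find (any⁻ (crossing S v) A crosses)
  ...   | e , e∈A , t with Equivalence.to T-∨ t
  ...     | inj₁ t₁ = let su , ev = Equivalence.to T-∧ t₁ in inj₂ (e , _ , e∈A , inj₁ (refl , toWitness ev) , su)
  ...     | inj₂ t₂ = let su , ev = Equivalence.to T-∧ t₂ in inj₂ (e , _ , e∈A , inj₂ (toWitness ev , refl) , su)

  grow-cong : ∀ {S S'} → S ≗ S' → grow S ≗ grow S'
  grow-cong {S} {S'} S≗S' v = cong₂ _∨_ (S≗S' v) (any-cong A)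
    where
    any-cong : ∀ es → any (crossing S v) es ≡ any (crossing S' v) es
    any-cong []       = refl
    any-cong (e ∷ es) = cong₂ _∨_ (cong₂ _∨_ (cong (_∧ _) (S≗S' (proj₁ e))) (cong (_∧ _) (S≗S' (proj₂ e)))) (any-cong es)

  iter-cong : ∀ k {S S'} → S ≗ S' → iter k S ≗ iter k S'
  iter-cong zero    S≗S' = S≗S'
  iter-cong (suc k) S≗S' = iter-cong k (grow-cong S≗S')

  iter-fixed : ∀ k {S} → grow S ≗ S → iter k S ≗ S
  iter-fixed zero    fixed v = refl
  iter-fixed (suc k) fixed v = trans (iter-cong k fixed v) (iter-fixed k fixed v)

-- Components of a subgraph of a star

leafOf : ∀ {n} → Fin n → Edge n → Fin n
leafOf c e = if ⌊ proj₁ e ≟ c ⌋ then proj₂ e else proj₁ e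

Spoke : ∀ {n} → Fin n → Edge n → Set
Spoke c e = Joins e c (leafOf c e) × leafOf c e ≢ c

spoke-ends : ∀ {n} {c : Fin n} {e u v} → Spoke c e → Joins e u v →
  (u ≡ c × v ≡ leafOf c e) ⊎ (u ≡ leafOf c e × v ≡ c)
spoke-ends (inj₁ (p , q) , _) (inj₁ (p' , q')) = inj₁ (trans (sym p') p , trans (sym q') q)
spoke-ends (inj₁ (p , q) , _) (inj₂ (p' , q')) = inj₂ (trans (sym q') q , trans (sym p') p)
spoke-ends (inj₂ (p , q) , _) (inj₁ (p' , q')) = inj₂ (trans (sym p') p , trans (sym q') q)
spoke-ends (inj₂ (p , q) , _) (inj₂ (p' , q')) = inj₁ (trans (sym q') q , trans (sym p') p)

≢⇒2≤ : ∀ {k} {a b : Fin k} → a ≢ b → 2 ≤ k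
≢⇒2≤ {suc zero}    {fzero} {fzero} a≢b = contradiction refl a≢b
≢⇒2≤ {suc (suc k)} _ = s≤s (s≤s z≤n)

module StarComponents {n : ℕ} (c : Fin n) (A : List (Edge n)) (spokes : All (Spoke c) A) where

  open Components A
  open Growth A

  central : Fin n → Bool
  central v = eqb c v ∨ any (λ e → eqb (leafOf c e) v) A

  central-centre : T (central c)
  central-centre = T-∨⁺ˡ _ (fromWitness {a? = c ≟ c} refl)

  central-leaf : ∀ {e} → e ∈ A → T (central (leafOf c e))
  central-leaf e∈A =
    T-∨⁺ʳ _ (any⁺ _ (Any.map (λ { refl → fromWitness refl }) e∈A))

  central⁻ : ∀ {v} → T (central v) → c ≡ v ⊎ ∃ λ e → e ∈ A × leafOf c e ≡ v
  central⁻ t with Equivalence.to T-∨ t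
  ... | inj₁ c≡v = inj₁ (toWitness c≡v)
  ... | inj₂ isLeaf with find (any⁻ _ A isLeaf)
  ...   | e , e∈A , l≡v = inj₂ (e , e∈A , toWitness l≡v)

  central-ends : ∀ {e u v} → e ∈ A → Joins e u v → T (central v)
  central-ends e∈A joins with spoke-ends (All.lookup spokes e∈A) joins
  ... | inj₁ (_ , refl) = central-leaf e∈A
  ... | inj₂ (_ , refl) = central-centre

  grow-central : ∀ {S} → (T ∘ S) ⊆ (T ∘ central) → (T ∘ grow S) ⊆ (T ∘ central)
  grow-central {S} S⊆ g with grow⁻ S g
  ... | inj₁ sv                       = S⊆ sv
  ... | inj₂ (_ , _ , e∈A , joins , _) = central-ends e∈A joins

  grow-saturates : ∀ {S} → (T ∘ S) ⊆ (T ∘ central) → T (S c) → grow S ≗ central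
  grow-saturates {S} S⊆ sc v = T-extensional (grow-central S⊆) reached
    where
    reached : T (central v) → T (grow S v)
    reached cv with central⁻ cv
    ... | inj₁ refl              = grow-inflationary S sc
    ... | inj₂ (e , e∈A , refl) = grow⁺ S e∈A (proj₁ (All.lookup spokes e∈A)) sc

  central-fixed : grow central ≗ central
  central-fixed = grow-saturates id central-centre

  iter-saturates : ∀ {S} → (T ∘ S) ⊆ (T ∘ central) → T (S c) → ∀ k → 1 ≤ k → iter k S ≗ central
  iter-saturates S⊆ sc (suc k) _ v =
    trans (iter-cong k (grow-saturates S⊆ sc) v) (iter-fixed k central-fixed v)

  singleton⊆central : ∀ {r} → T (central r) → (T ∘ eqb r) ⊆ (T ∘ central)
  singleton⊆central cr r≡v = subst (T ∘ central) (toWitness r≡v) cr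

  -- comp iterates n rounds of growth; from a leaf it takes one round to reach the centre.
  comp-central : ∀ {r} → T (central r) → comp r ≗ central
  comp-central cr with central⁻ cr
  ... | inj₁ refl = iter-saturates (singleton⊆central cr) (fromWitness refl) n (≤-trans (s≤s z≤n) (Fin.toℕ<n c))
  ... | inj₂ (e , e∈A , refl) = λ v → iter-after-step n (≢⇒2≤ (proj₂ (All.lookup spokes e∈A))) v
    where
    l : Fin n
    l = leafOf c e
    iter-after-step : ∀ k → 2 ≤ k → iter k (eqb l) ≗ central
    iter-after-step (suc k) (s≤s 1≤k) =
      iter-saturates (grow-central (singleton⊆central cr))
                     (grow⁺ (eqb l) e∈A (Joins-sym (proj₁ (All.lookup spokes e∈A))) (fromWitness refl)) k 1≤k

  comp-isolated : ∀ {r} → ¬ T (central r) → comp r ≗ eqb r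
  comp-isolated {r} ¬cr = iter-fixed n isolated
    where
    isolated : grow (eqb r) ≗ eqb r
    isolated v = T-extensional stays (grow-inflationary (eqb r))
      where
      stays : T (grow (eqb r) v) → T (eqb r v)
      stays g with grow⁻ (eqb r) g
      ... | inj₁ rv = rv
      ... | inj₂ (_ , _ , e∈A , joins , r≡u) =
        contradiction (subst (T ∘ central) (sym (toWitness r≡u)) (central-ends e∈A (Joins-sym joins))) ¬cr

minimal : ∀ {k} (P : Fin k → Bool) {x} → T (P x) → ∃ λ r → T (P r) × ∀ v → T (P v) → toℕ r ≤ toℕ v
minimal {suc k} P {x} px with T? (P fzero)
... | yes p0 = fzero , p0 , λ _ _ → z≤n
... | no ¬p0 with x
...   | fzero   = contradiction px ¬p0
...   | fsuc x' =
  let r , pr , least = minimal (P ∘ fsuc) px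
  in fsuc r , pr , λ { fzero p → contradiction p ¬p0 ; (fsuc v) p → s≤s (least v p) }

sum-const : ∀ {X : Set} a (xs : List X) → sum (map (λ _ → a) xs) ≡ length xs * a
sum-const a []       = refl
sum-const a (x ∷ xs) = cong (_+_ a) (sum-const a xs)

markW : ∀ {n} → (Fin n → ℕ) → Fin n → Mark
markW w v = (w v , 0)

∔-foldr : ∀ {X : Set} (w : X → ℕ) a xs →
  foldr (λ v acc → (w v , 0) ∔ acc) (a , 0) xs ≡ (sum (map w xs) + a , length xs)
∔-foldr w a []       = refl
∔-foldr w a (x ∷ xs) rewrite ∔-foldr w a xs =
  cong₂ _,_ (sym (+-assoc (w x) _ a)) (+-comm (length xs) 1)

isRoot⇔ : ∀ {n} (A : List (Edge n)) r →
  T (Components.isRoot A r) ⇔ (∀ v → T (Components.comp A r v) → toℕ r ≤ toℕ v)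
isRoot⇔ {n} A r = mk⇔
  (λ t v cv → toWitness (Equivalence.to T-implies (All.lookup (all⁺ minimum (allFin n) t) (∈-allFin v)) cv))
  (λ least → all⁻ minimum {allFin n} (All.tabulate λ {v} _ → Equivalence.from T-implies (fromWitness ∘ least v)))
  where
  minimum : Fin n → Bool
  minimum v = not (Components.comp A r v) ∨ ⌊ toℕ r ≤? toℕ v ⌋

module StarRoots {n : ℕ} (c : Fin n) (A : List (Edge n)) (spokes : All (Spoke c) A) where

  open Components A
  open StarComponents c A spokes

  private
    minimal-central : ∃ λ r → T (central r) × ∀ v → T (central v) → toℕ r ≤ toℕ v
    minimal-central = minimal central central-centre

  root : Fin n
  root = proj₁ minimal-central

  root-central : T (central root)
  root-central = proj₁ (proj₂ minimal-central)

  isRoot-root : T (isRoot root)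
  isRoot-root = Equivalence.from (isRoot⇔ A root)
    λ v cv → proj₂ (proj₂ minimal-central) v (subst T (comp-central root-central v) cv)

  isRoot-central : ∀ {r} → T (central r) → T (isRoot r) → r ≡ root
  isRoot-central {r} cr ir = Fin.≤-antisym
    (Equivalence.to (isRoot⇔ A r) ir root (subst T (sym (comp-central cr root)) root-central))
    (proj₂ (proj₂ minimal-central) r cr)

  isRoot-isolated : ∀ {r} → ¬ T (central r) → T (isRoot r)
  isRoot-isolated {r} ¬cr = Equivalence.from (isRoot⇔ A r)
    λ v cv → Fin.≤-reflexive (toWitness (subst T (comp-isolated ¬cr v) cv))

  module _ {X : Set} {_∙_ : Op₂ X} {ε : X} (isCM : IsCommutativeMonoid _≡_ _∙_ ε) where

    open IsCommutativeMonoid isCM using (identityˡ; identityʳ)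
    open BigOperator isCM

    big-roots : ∀ (F : Fin n → X) →
      big (map F roots) ≡ F root ∙ big (map (λ r → if central r then ε else F r) (allFin n))
    big-roots F = begin
      big (map F roots)
        ≡⟨ big-filter isRoot F (allFin n) ⟩
      big (map (λ r → if isRoot r then F r else ε) (allFin n))
        ≡⟨ cong big (map-cong root-split (allFin n)) ⟩
      big (map (λ r → (if eqb root r then F r else ε) ∙ (if central r then ε else F r)) (allFin n))
        ≡⟨ big-∙ _ _ (allFin n) ⟩
      big (map (λ r → if eqb root r then F r else ε) (allFin n)) ∙ big (map (λ r → if central r then ε else F r) (allFin n))
        ≡⟨ cong (_∙ big (map (λ r → if central r then ε else F r) (allFin n))) (big-unique (eqb root) F (fromWitness refl) (sym ∘ toWitness)) ⟩
      F root ∙ big (map (λ r → if central r then ε else F r) (allFin n)) ∎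
      where
      open ≡-Reasoning
      root-split : ∀ r → (if isRoot r then F r else ε) ≡ (if eqb root r then F r else ε) ∙ (if central r then ε else F r)
      root-split r with T? (central r)
      ... | no ¬cr
        rewrite T⇒≡true (isRoot-isolated ¬cr) | ¬T⇒≡false ¬cr
              | ¬T⇒≡false {eqb root r} (λ root≡r → ¬cr (subst (T ∘ central) (toWitness root≡r) root-central))
              = sym (identityˡ _)
      ... | yes cr with root ≟ r
      ...   | yes refl rewrite T⇒≡true isRoot-root | T⇒≡true cr = sym (identityʳ _)
      ...   | no root≢r rewrite T⇒≡true cr | ¬T⇒≡false (root≢r ∘ sym ∘ isRoot-central cr) = sym (identityˡ ε)

  centralSum : (Fin n → ℕ) → ℕ
  centralSum f = sum (map (λ v → if central v then f v else 0) (allFin n))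

  module _ {r : Fin n} (cr : T (central r)) where

    others : List (Fin n)
    others = filter (λ v → (comp r v ∧ not (eqb r v)) Bool.≟ true) (allFin n)

    others-sum : ∀ f → sum (map f others) + f r ≡ centralSum f
    others-sum f = begin
      sum (map f others) + f r
        ≡⟨ cong₂ _+_ (NatSum.big-filter _ f (allFin n)) (sym (NatSum.big-unique (eqb r) f (fromWitness refl) (sym ∘ toWitness))) ⟩
      sum (map (λ v → if comp r v ∧ not (eqb r v) then f v else 0) (allFin n))
        + sum (map (λ v → if eqb r v then f v else 0) (allFin n))
        ≡⟨ sym (NatSum.big-∙ _ _ (allFin n)) ⟩
      sum (map (λ v → (if comp r v ∧ not (eqb r v) then f v else 0) + (if eqb r v then f v else 0)) (allFin n))
        ≡⟨ cong sum (map-cong split (allFin n)) ⟩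
      centralSum f ∎
      where
      open ≡-Reasoning
      split : ∀ v → (if comp r v ∧ not (eqb r v) then f v else 0) + (if eqb r v then f v else 0)
                  ≡ (if central v then f v else 0)
      split v rewrite comp-central cr v with r ≟ v
      ... | yes refl rewrite T⇒≡true cr = refl
      ... | no _ with central v
      ...   | true  = +-identityʳ (f v)
      ...   | false = refl

    compMark-central : ∀ w → compMark (markW w) r ≡ (centralSum w , length others)
    compMark-central w = trans (∔-foldr w (w r) others) (cong (_, length others) (others-sum w))

    length-others : suc (length others) ≡ centralSum (λ _ → 1)
    length-others = begin
      suc (length others)                ≡⟨ +-comm 1 (length others) ⟩
      length others + 1                  ≡⟨ cong (_+ 1) (trans (sum-const 1 others) (*-identityʳ _)) ⟨
      sum (map (λ _ → 1) others) + 1     ≡⟨ others-sum (λ _ → 1) ⟩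
      centralSum (λ _ → 1)               ∎
      where open ≡-Reasoning

  compMark-isolated : ∀ w {r} → ¬ T (central r) → compMark (markW w) r ≡ (w r , 0)
  compMark-isolated w {r} ¬cr =
    cong (foldr (λ v acc → markW w v ∔ acc) (w r , 0)) (filter-none (λ v → (comp r v ∧ not (eqb r v)) Bool.≟ true) {allFin n} (All.tabulate λ {v} _ → alone v))
    where
    alone : ∀ v → (comp r v ∧ not (eqb r v)) ≢ true
    alone v rewrite comp-isolated ¬cr v with eqb r v
    ... | true  = λ ()
    ... | false = λ ()

sel : ∀ {X : Set} → List Bool → List X → List X
sel []           xs       = []
sel (b ∷ bs)     []       = []
sel (true  ∷ bs) (x ∷ xs) = x ∷ sel bs xs
sel (false ∷ bs) (x ∷ xs) = sel bs xs

bools : ℕ → List (List Bool)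
bools zero    = [] ∷ []
bools (suc k) = map (false ∷_) (bools k) ++ map (true ∷_) (bools k)

bools-length : ∀ k → All (λ bs → length bs ≡ k) (bools k)
bools-length zero    = refl ∷ []
bools-length (suc k) = All.++⁺ (All.map⁺ (All.map (cong suc) (bools-length k)))
                                (All.map⁺ (All.map (cong suc) (bools-length k)))

length-bools : ∀ k → length (bools k) ≡ 2 ^ k
length-bools zero    = refl
length-bools (suc k) = begin
  length (map (false ∷_) (bools k) ++ map (true ∷_) (bools k))
    ≡⟨ length-++ (map (false ∷_) (bools k)) ⟩
  length (map (false ∷_) (bools k)) + length (map (true ∷_) (bools k))
    ≡⟨ cong₂ _+_ (length-map _ (bools k)) (length-map _ (bools k)) ⟩
  length (bools k) + length (bools k)
    ≡⟨ cong (λ l → l + l) (length-bools k) ⟩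
  2 ^ k + 2 ^ k
    ≡⟨ cong (_+_ (2 ^ k)) (+-identityʳ (2 ^ k)) ⟨
  2 ^ suc k ∎
  where open ≡-Reasoning

sublists-sel : ∀ {X : Set} (xs : List X) → sublists xs ≡ map (λ bs → sel bs xs) (bools (length xs))
sublists-sel []       = refl
sublists-sel (x ∷ xs) = begin
  sublists xs ++ map (x ∷_) (sublists xs)
    ≡⟨ cong (λ ss → ss ++ map (x ∷_) ss) (sublists-sel xs) ⟩
  map (λ bs → sel bs xs) B ++ map (x ∷_) (map (λ bs → sel bs xs) B)
    ≡⟨ cong₂ _++_ (map-∘ B) (trans (sym (map-∘ B)) (map-∘ B)) ⟩
  map (λ bs → sel bs (x ∷ xs)) (map (false ∷_) B) ++ map (λ bs → sel bs (x ∷ xs)) (map (true ∷_) B)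
    ≡⟨ sym (map-++ (λ bs → sel bs (x ∷ xs)) (map (false ∷_) B) (map (true ∷_) B)) ⟩
  map (λ bs → sel bs (x ∷ xs)) (bools (length (x ∷ xs))) ∎
  where
  open ≡-Reasoning
  B : List (List Bool)
  B = bools (length xs)

sel-map : ∀ {X Y : Set} (f : X → Y) bs xs → sel bs (map f xs) ≡ map f (sel bs xs)
sel-map f (true  ∷ bs) (x ∷ xs) = cong (f x ∷_) (sel-map f bs xs)
sel-map f (false ∷ bs) (x ∷ xs) = sel-map f bs xs
sel-map f []           xs       = refl
sel-map f (b ∷ bs)     []       = refl

All-sel : ∀ {X : Set} {P : X → Set} bs {xs} → All P xs → All P (sel bs xs)
All-sel (true  ∷ bs) (px ∷ pxs) = px ∷ All-sel bs pxs
All-sel (false ∷ bs) (px ∷ pxs) = All-sel bs pxs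
All-sel []           _          = []
All-sel (b ∷ bs)     []         = []

sel-⊆ : ∀ {X : Set} bs {xs : List X} {y} → y ∈ sel bs xs → y ∈ xs
sel-⊆ (true  ∷ bs) {x ∷ xs} (here y≡x) = here y≡x
sel-⊆ (true  ∷ bs) {x ∷ xs} (there y∈) = there (sel-⊆ bs y∈)
sel-⊆ (false ∷ bs) {x ∷ xs} y∈         = there (sel-⊆ bs y∈)

sum-zipWith-sel : ∀ {X : Set} (f : X → ℕ) bs xs →
  sum (zipWith (λ b x → if b then f x else 0) bs xs) ≡ sum (map f (sel bs xs))
sum-zipWith-sel f []           xs       = refl
sum-zipWith-sel f (b ∷ bs)     []       = refl
sum-zipWith-sel f (true  ∷ bs) (x ∷ xs) = cong (_+_ (f x)) (sum-zipWith-sel f bs xs)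
sum-zipWith-sel f (false ∷ bs) (x ∷ xs) = sum-zipWith-sel f bs xs

memb : ∀ {n} → Fin n → List (Fin n) → Bool
memb x ys = any (λ y → ⌊ y ≟ x ⌋) ys

memb-sel : ∀ {n} {Y : Set} (H : Bool → Fin n → Y) bs xs → Unique xs → length bs ≡ length xs →
  map (λ x → H (memb x (sel bs xs)) x) xs ≡ zipWith H bs xs
memb-sel H []       []       _                  _   = refl
memb-sel H (b ∷ bs) (x ∷ xs) (x∉xs ∷ unique) len =
  cong₂ _∷_ (cong (λ t → H t x) (memb-head b))
            (trans (map-cong-local (All.map (λ x≢y → cong (λ t → H t _) (memb-tail b x≢y)) x∉xs))
                   (memb-sel H bs xs unique (ℕ.suc-injective len)))
  where
  x∉sel : ¬ T (memb x (sel bs xs))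
  x∉sel t = let y , y∈ , y≡x = find (any⁻ _ (sel bs xs) t)
            in All.lookup x∉xs (sel-⊆ bs y∈) (sym (toWitness y≡x))
  memb-head : ∀ b → memb x (sel (b ∷ bs) (x ∷ xs)) ≡ b
  memb-head true  = T⇒≡true (T-∨⁺ˡ _ (fromWitness {a? = x ≟ x} refl))
  memb-head false = ¬T⇒≡false x∉sel
  memb-tail : ∀ b {y} → x ≢ y → memb y (sel (b ∷ bs) (x ∷ xs)) ≡ memb y (sel bs xs)
  memb-tail true {y} x≢y = cong (_∨ memb y (sel bs xs)) (¬T⇒≡false {⌊ x ≟ y ⌋} (x≢y ∘ toWitness))
  memb-tail false _   = refl

incident⇒spoke : ∀ {n} {c : Fin n} {e} → proj₁ e ≡ c ⊎ proj₂ e ≡ c → proj₁ e ≢ proj₂ e → Spoke c e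
incident⇒spoke {c = c} {e} (inj₁ e₁≡c) noLoop with proj₁ e ≟ c
... | yes _    = inj₁ (e₁≡c , refl) , λ e₂≡c → noLoop (trans e₁≡c (sym e₂≡c))
... | no e₁≢c  = contradiction e₁≡c e₁≢c
incident⇒spoke {c = c} {e} (inj₂ e₂≡c) noLoop with proj₁ e ≟ c
... | yes e₁≡c = contradiction (trans e₁≡c (sym e₂≡c)) noLoop
... | no e₁≢c  = inj₂ (refl , e₂≡c) , e₁≢c

spokes-sameLeaf : ∀ {n} {c : Fin n} {e f} → Spoke c e → Spoke c f → leafOf c e ≡ leafOf c f → SameEdge e f
spokes-sameLeaf {e = _ , _} {_ , _} (joins , _) (joins' , _) l≡l' with joins | joins'
... | inj₁ (a , b) | inj₁ (a' , b') = inj₁ (trans a (sym a') , trans b (trans l≡l' (sym b')))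
... | inj₁ (a , b) | inj₂ (a' , b') = inj₂ (trans a (sym b') , trans b (trans l≡l' (sym a')))
... | inj₂ (a , b) | inj₁ (a' , b') = inj₂ (trans a (trans l≡l' (sym b')) , trans b (sym a'))
... | inj₂ (a , b) | inj₂ (a' , b') = inj₁ (trans a (trans l≡l' (sym a')) , trans b (sym b'))

module Star (G : Graph) (isTree : IsTree G) (c : Fin (size G))
            (incident : All (λ e → proj₁ e ≡ c ⊎ proj₂ e ≡ c) (edges G)) where

  private
    n : ℕ
    n = size G
    E : List (Edge n)
    E = edges G

  spokes : All (Spoke c) E
  spokes = All.zipWith (λ (inc , noLoop) → incident⇒spoke inc noLoop) (incident , proj₁ (proj₁ isTree))

  leaves : List (Fin n)
  leaves = map (leafOf c) E

  leaves-unique : Unique leaves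
  leaves-unique = AllPairs.map⁺ (distinct spokes (proj₂ (proj₁ isTree)))
    where
    distinct : ∀ {es} → All (Spoke c) es → AllPairs (λ e f → ¬ SameEdge e f) es →
               AllPairs (λ e f → leafOf c e ≢ leafOf c f) es
    distinct []       []       = []
    distinct (s ∷ ss) (d ∷ ds) =
      All.zipWith (λ (s' , ¬same) l≡l' → ¬same (spokes-sameLeaf s s' l≡l')) (ss , d) ∷ distinct ss ds

  centre∉leaves : All (c ≢_) leaves
  centre∉leaves = All.map⁺ (All.map (λ (_ , l≢c) → l≢c ∘ sym) spokes)

  Adj⇒Joins : ∀ {u v} → Adj G u v → ∃ λ e → e ∈ E × Joins e u v
  Adj⇒Joins adj = find (Any-⊎⁺ adj)

  Joins⇒Adj : ∀ {e u v} → e ∈ E → Joins e u v → Adj G u v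
  Joins⇒Adj e∈E joins = Any-⊎⁻ (Any.map (λ { refl → joins }) e∈E)

  centre-or-leaf : ∀ v → v ≡ c ⊎ v ∈ leaves
  centre-or-leaf v = reached (proj₂ (proj₂ isTree) c v)
    where
    reached : ∀ {v} → Reach G c v → v ≡ c ⊎ v ∈ leaves
    reached here         = inj₁ refl
    reached (step _ adj) with Adj⇒Joins adj
    ... | e , e∈E , joins with spoke-ends (All.lookup spokes e∈E) joins
    ...   | inj₁ (_ , refl) = inj₂ (∈-map⁺ (leafOf c) e∈E)
    ...   | inj₂ (_ , refl) = inj₁ refl

  centre∷leaves↭ : c ∷ leaves ↭ allFin n
  centre∷leaves↭ = ∼bag⇒↭ (unique∧set⇒bag (centre∉leaves ∷ leaves-unique) (allFin⁺ n)
                                          (mk⇔ (λ _ → ∈-allFin _) covered))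
    where
    covered : ∀ {v} → v ∈ allFin n → v ∈ c ∷ leaves
    covered {v} _ with centre-or-leaf v
    ... | inj₁ v≡c = here v≡c
    ... | inj₂ v∈  = there v∈

  Adj⇔ : ∀ {u v} → Adj G u v ⇔ ((u ≡ c × v ≢ c) ⊎ (v ≡ c × u ≢ c))
  Adj⇔ = mk⇔ to from
    where
    to : ∀ {u v} → Adj G u v → (u ≡ c × v ≢ c) ⊎ (v ≡ c × u ≢ c)
    to adj with Adj⇒Joins adj
    ... | e , e∈E , joins with spoke-ends (All.lookup spokes e∈E) joins
    ...   | inj₁ (u≡c , refl) = inj₁ (u≡c , proj₂ (All.lookup spokes e∈E))
    ...   | inj₂ (refl , v≡c) = inj₂ (v≡c , proj₂ (All.lookup spokes e∈E))
    spoke-to : ∀ {v} → v ≢ c → ∃ λ e → e ∈ E × Joins e c v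
    spoke-to {v} v≢c with centre-or-leaf v
    ... | inj₁ v≡c = contradiction v≡c v≢c
    ... | inj₂ v∈ with ∈-map⁻ (leafOf c) v∈
    ...   | e , e∈E , refl = e , e∈E , proj₁ (All.lookup spokes e∈E)
    from : ∀ {u v} → (u ≡ c × v ≢ c) ⊎ (v ≡ c × u ≢ c) → Adj G u v
    from (inj₁ (refl , v≢c)) = let e , e∈E , joins = spoke-to v≢c in Joins⇒Adj e∈E joins
    from (inj₂ (refl , u≢c)) = let e , e∈E , joins = spoke-to u≢c in Joins⇒Adj e∈E (Joins-sym joins)

-- The M-polynomial of a weighted star

-- The spokes selected by bs join the centre into one component of mark (γ + Σ selected, #selected);
-- every unselected leaf is a component on its own.
starTerm : ℕ → List ℕ → (ℕ → ℕ → Dual) → List Bool → Dual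
starTerm γ ws z bs =
  z (γ + sum (sel bs ws)) (length (sel bs ws)) ⊗ DualProduct.big (zipWith (λ b w → if b then 1ᵈ else z w 0) bs ws)

starM : ℕ → List ℕ → (ℕ → ℕ → Dual) → Dual
starM γ ws z = DualSum.big (map (starTerm γ ws z) (bools (length ws)))

module StarSubgraph (G : Graph) (isTree : IsTree G) (c : Fin (size G))
                    (incident : All (λ e → proj₁ e ≡ c ⊎ proj₂ e ≡ c) (edges G))
                    (bs : List Bool) (length-bs : length bs ≡ length (edges G)) where

  open Star G isTree c incident
  open Components (sel bs (edges G)) using (compMark; roots)
  open StarComponents c (sel bs (edges G)) (All-sel bs spokes) using (central; central-centre)
  open StarRoots c (sel bs (edges G)) (All-sel bs spokes)

  private
    n : ℕ
    n = size G

  central-leaf≡ : ∀ {x} → x ∈ leaves → central x ≡ memb x (sel bs leaves)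
  central-leaf≡ {x} x∈ = cong₂ _∨_
    (¬T⇒≡false (All.lookup centre∉leaves x∈ ∘ toWitness))
    (cong or (trans (map-∘ (sel bs (edges G))) (cong (map _) (sym (sel-map (leafOf c) bs (edges G))))))

  module _ {X : Set} {_∙_ : Op₂ X} {ε : X} (isCM : IsCommutativeMonoid _≡_ _∙_ ε) where

    open BigOperator isCM

    big-central : ∀ (H : Bool → Fin n → X) →
      big (map (λ v → H (central v) v) (allFin n)) ≡ H true c ∙ big (zipWith H bs leaves)
    big-central H = begin
      big (map (λ v → H (central v) v) (allFin n))
        ≡⟨ big-↭ (map⁺ _ (↭-sym centre∷leaves↭)) ⟩
      H (central c) c ∙ big (map (λ v → H (central v) v) leaves)
        ≡⟨ cong₂ (λ b ys → H b c ∙ big ys) (T⇒≡true central-centre)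
                 (map-cong-local (All.tabulate (cong (λ b → H b _) ∘ central-leaf≡))) ⟩
      H true c ∙ big (map (λ x → H (memb x (sel bs leaves)) x) leaves)
        ≡⟨ cong (λ ys → H true c ∙ big ys) (memb-sel H bs leaves leaves-unique (trans length-bs (sym (length-map _ (edges G))))) ⟩
      H true c ∙ big (zipWith H bs leaves) ∎
      where open ≡-Reasoning

  centralSum-sel : ∀ f → centralSum f ≡ f c + sum (map f (sel bs leaves))
  centralSum-sel f = trans (big-central +-0-isCommutativeMonoid (λ b v → if b then f v else 0))
                           (cong (_+_ (f c)) (sum-zipWith-sel f bs leaves))

  module _ (ω : Fin n → ℕ) (z : ℕ → ℕ → Dual) where

    private
      ws = map ω leaves
      F : Fin n → Dual
      F r = z (proj₁ (compMark (markW ω) r)) (proj₂ (compMark (markW ω) r))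

    root-factor : F root ≡ z (ω c + sum (sel bs ws)) (length (sel bs ws))
    root-factor = trans (cong (λ m → z (proj₁ m) (proj₂ m)) (compMark-central root-central ω))
                        (cong₂ z weight≡ (ℕ.suc-injective size≡))
      where
      weight≡ : centralSum ω ≡ ω c + sum (sel bs ws)
      weight≡ = trans (centralSum-sel ω) (cong (_+_ (ω c)) (cong sum (sym (sel-map ω bs leaves))))
      size≡ : suc (length (others root-central)) ≡ suc (length (sel bs ws))
      size≡ = begin
        suc (length (others root-central))    ≡⟨ length-others root-central ⟩
        centralSum (λ _ → 1)                  ≡⟨ centralSum-sel (λ _ → 1) ⟩
        suc (sum (map (λ _ → 1) (sel bs leaves))) ≡⟨ cong suc (trans (sum-const 1 (sel bs leaves)) (*-identityʳ _)) ⟩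
        suc (length (sel bs leaves))          ≡⟨ cong suc (sym (trans (cong length (sel-map ω bs leaves)) (length-map ω (sel bs leaves)))) ⟩
        suc (length (sel bs ws))              ∎
        where open ≡-Reasoning

    isolated-factor : ∀ r → (if central r then 1ᵈ else F r) ≡ (if central r then 1ᵈ else z (ω r) 0)
    isolated-factor r with T? (central r)
    ... | yes cr rewrite T⇒≡true cr = refl
    ... | no ¬cr rewrite ¬T⇒≡false ¬cr = cong (λ m → z (proj₁ m) (proj₂ m)) (compMark-isolated ω ¬cr)

    components-star : DualProduct.big (map F roots) ≡ starTerm (ω c) ws z bs
    components-star = begin
      DualProduct.big (map F roots)
        ≡⟨ big-roots ⊗-isCommutativeMonoid F ⟩
      F root ⊗ DualProduct.big (map (λ r → if central r then 1ᵈ else F r) (allFin n))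
        ≡⟨ cong₂ _⊗_ root-factor (cong DualProduct.big (map-cong isolated-factor (allFin n))) ⟩
      centreFactor ⊗ DualProduct.big (map (λ r → if central r then 1ᵈ else z (ω r) 0) (allFin n))
        ≡⟨ cong (centreFactor ⊗_) (big-central ⊗-isCommutativeMonoid (λ b v → if b then 1ᵈ else z (ω v) 0)) ⟩
      centreFactor ⊗ (1ᵈ ⊗ DualProduct.big (zipWith (λ b v → if b then 1ᵈ else z (ω v) 0) bs leaves))
        ≡⟨ cong (centreFactor ⊗_) (⊗-identityˡ _) ⟩
      centreFactor ⊗ DualProduct.big (zipWith (λ b v → if b then 1ᵈ else z (ω v) 0) bs leaves)
        ≡⟨ cong (λ ys → centreFactor ⊗ DualProduct.big ys) (sym (trans (cong (λ bs' → zipWith _ bs' ws) (sym (map-id bs)))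
                                                   (zipWith-map (λ b w → if b then 1ᵈ else z w 0) id ω bs leaves))) ⟩
      starTerm (ω c) ws z bs ∎
      where
      open ≡-Reasoning
      centreFactor : Dual
      centreFactor = z (ω c + sum (sel bs ws)) (length (sel bs ws))

-- Evaluation at a linear probe

probe : (ℕ → ℕ) → ℕ → ℕ → Dual
probe h w _ = if w ≡ᵇ 1 then 0ᵈ else + 1 +ε + h w

probe-≥2 : ∀ h {w} d → 2 ≤ w → probe h w d ≡ + 1 +ε + h w
probe-≥2 h {suc (suc w)} d _         = refl
probe-≥2 h {suc zero}    d (s≤s ())

·-zeroʳ : ∀ k → Poly._·_ dualRing k 0ᵈ ≡ 0ᵈ
·-zeroʳ zero    = refl
·-zeroʳ (suc k) = cong (0ᵈ ⊕_) (·-zeroʳ k)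

Dsub-collapse : ∀ z → z 1 0 ≡ 0ᵈ → ∀ w d → Poly.Dsub dualRing z w d ≡ z w 0
Dsub-collapse z z₁₀≡0 w d = begin
  term 0 ⊕ DualSum.big (map term (applyUpTo suc d))
    ≡⟨ cong₂ _⊕_ leading (DualSum.big-≡ε (All.map⁺ (All.applyUpTo⁺₂ suc d vanishing))) ⟩
  z w 0 ⊕ 0ᵈ
    ≡⟨ ⊕-identityʳ (z w 0) ⟩
  z w 0 ∎
  where
  open ≡-Reasoning
  open Poly dualRing using (sgn; _·_) renaming (_^_ to _^ᵈ_)
  term : ℕ → Dual
  term i = sgn i ⊗ ((d C i) · (z (w ∸ i) 0 ⊗ (z 1 0 ^ᵈ i)))
  leading : term 0 ≡ z w 0
  leading = trans (⊗-identityˡ _) (trans (⊕-identityʳ _) (⊗-identityʳ (z w 0)))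
  vanishing : ∀ i → term (suc i) ≡ 0ᵈ
  vanishing i rewrite z₁₀≡0 | ⊗-zeroˡ (0ᵈ ^ᵈ i) | ⊗-zeroʳ (z (w ∸ suc i) 0) | ·-zeroʳ (d C suc i) = ⊗-zeroʳ (sgn (suc i))

1+ε-⊗ : ∀ a b → (+ 1 +ε + a) ⊗ (+ 1 +ε + b) ≡ + 1 +ε + (a + b)
1+ε-⊗ a b = cong (+ 1 +ε_) (begin
  + 1 ℤ.* + b ℤ.+ + a ℤ.* + 1 ≡⟨ cong₂ ℤ._+_ (ℤ.*-identityˡ (+ b)) (ℤ.*-identityʳ (+ a)) ⟩
  + b ℤ.+ + a                 ≡⟨ ℤ.+-comm (+ b) (+ a) ⟩
  + a ℤ.+ + b                 ≡⟨ ℤ.pos-+ a b ⟨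
  + (a + b)                   ∎)
  where open ≡-Reasoning

⊕-1+ε : ∀ {X : Set} (f : X → ℕ) xs → DualSum.big (map (λ x → + 1 +ε + f x) xs) ≡ + length xs +ε + sum (map f xs)
⊕-1+ε f []       = refl
⊕-1+ε f (x ∷ xs) rewrite ⊕-1+ε f xs = cong₂ _+ε_ (sym (ℤ.pos-+ 1 (length xs))) (sym (ℤ.pos-+ (f x) _))

unselected : (ℕ → ℕ) → List Bool → List ℕ → ℕ
unselected h bs ws = sum (zipWith (λ b w → if b then 0 else h w) bs ws)

starSum : ℕ → List ℕ → (ℕ → ℕ) → ℕ
starSum γ ws h = sum (map (λ bs → h (γ + sum (sel bs ws)) + unselected h bs ws) (bools (length ws)))

⊗-unselected : ∀ h bs ws → All (2 ≤_) ws →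
  DualProduct.big (zipWith (λ b w → if b then 1ᵈ else Poly.Dsub dualRing (probe h) w 0) bs ws) ≡ + 1 +ε + unselected h bs ws
⊗-unselected h []           ws       _            = refl
⊗-unselected h (b ∷ bs)     []       _            = refl
⊗-unselected h (true  ∷ bs) (w ∷ ws) (_ ∷ ws≥2)   = trans (⊗-identityˡ _) (⊗-unselected h bs ws ws≥2)
⊗-unselected h (false ∷ bs) (w ∷ ws) (w≥2 ∷ ws≥2) = begin
  Poly.Dsub dualRing (probe h) w 0 ⊗ _
    ≡⟨ cong₂ _⊗_ (trans (Dsub-collapse (probe h) refl w 0) (probe-≥2 h 0 w≥2)) (⊗-unselected h bs ws ws≥2) ⟩
  (+ 1 +ε + h w) ⊗ (+ 1 +ε + unselected h bs ws)
    ≡⟨ 1+ε-⊗ (h w) _ ⟩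
  + 1 +ε + unselected h (false ∷ bs) (w ∷ ws) ∎
  where open ≡-Reasoning

starM-probe : ∀ h γ ws → 2 ≤ γ → All (2 ≤_) ws →
  starM γ ws (Poly.Dsub dualRing (probe h)) ≡ + 2 ^ length ws +ε + starSum γ ws h
starM-probe h γ ws γ≥2 ws≥2 = begin
  DualSum.big (map (starTerm γ ws z) (bools (length ws)))
    ≡⟨ cong DualSum.big (map-cong linear (bools (length ws))) ⟩
  DualSum.big (map (λ bs → + 1 +ε + (h (γ + sum (sel bs ws)) + unselected h bs ws)) (bools (length ws)))
    ≡⟨ ⊕-1+ε _ (bools (length ws)) ⟩
  + length (bools (length ws)) +ε + starSum γ ws h
    ≡⟨ cong (λ k → + k +ε + starSum γ ws h) (length-bools (length ws)) ⟩
  + 2 ^ length ws +ε + starSum γ ws h ∎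
  where
  open ≡-Reasoning
  z : ℕ → ℕ → Dual
  z = Poly.Dsub dualRing (probe h)
  linear : ∀ bs → starTerm γ ws z bs ≡ + 1 +ε + (h (γ + sum (sel bs ws)) + unselected h bs ws)
  linear bs = trans (cong₂ _⊗_ (trans (Dsub-collapse (probe h) refl W (length (sel bs ws)))
                                      (probe-≥2 h 0 (≤-trans γ≥2 (m≤m+n γ (sum (sel bs ws))))))
                               (⊗-unselected h bs ws ws≥2))
                    (1+ε-⊗ (h W) (unselected h bs ws))
    where
    W : ℕ
    W = γ + sum (sel bs ws)

-- Recovering a centre weight and a multiset of leaf weights

sublistSum : (ℕ → ℕ) → List ℕ → ℕ → ℕ
sublistSum h xs a = sum (map (λ S → h (a + sum S)) (sublists xs))

sublistSum-cons : ∀ h x xs a → sublistSum h (x ∷ xs) a ≡ sublistSum h xs a + sublistSum h xs (a + x)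
sublistSum-cons h x xs a = begin
  sum (map g (sublists xs ++ map (x ∷_) (sublists xs)))
    ≡⟨ cong sum (map-++ g (sublists xs) _) ⟩
  sum (map g (sublists xs) ++ map g (map (x ∷_) (sublists xs)))
    ≡⟨ NatSum.big-++ (map g (sublists xs)) _ ⟩
  sublistSum h xs a + sum (map g (map (x ∷_) (sublists xs)))
    ≡⟨ cong (λ ys → sublistSum h xs a + sum ys) (trans (sym (map-∘ (sublists xs))) (map-cong shifted (sublists xs))) ⟩
  sublistSum h xs a + sublistSum h xs (a + x) ∎
  where
  open ≡-Reasoning
  g : List ℕ → ℕ
  g S = h (a + sum S)
  shifted : ∀ S → h (a + (x + sum S)) ≡ h (a + x + sum S)
  shifted S = cong h (sym (+-assoc a x (sum S)))

sublistSum-↭ : ∀ h {xs ys} → xs ↭ ys → ∀ a → sublistSum h xs a ≡ sublistSum h ys a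
sublistSum-↭ h ↭.refl          a = refl
sublistSum-↭ h (↭.prep {xs} {ys} x p) a = begin
  sublistSum h (x ∷ xs) a                         ≡⟨ sublistSum-cons h x xs a ⟩
  sublistSum h xs a + sublistSum h xs (a + x)     ≡⟨ cong₂ _+_ (sublistSum-↭ h p a) (sublistSum-↭ h p (a + x)) ⟩
  sublistSum h ys a + sublistSum h ys (a + x)     ≡⟨ sublistSum-cons h x ys a ⟨
  sublistSum h (x ∷ ys) a                         ∎
  where open ≡-Reasoning
sublistSum-↭ h (↭.swap {xs} {ys} x y p) a = begin
  sublistSum h (x ∷ y ∷ xs) a
    ≡⟨ trans (sublistSum-cons h x (y ∷ xs) a) (cong₂ _+_ (sublistSum-cons h y xs a) (sublistSum-cons h y xs (a + x))) ⟩
  (Φ xs a + Φ xs (a + y)) + (Φ xs (a + x) + Φ xs (a + x + y))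
    ≡⟨ cong (λ t → (Φ xs a + Φ xs (a + y)) + (Φ xs (a + x) + Φ xs t)) (x+y≡y+x a) ⟩
  (Φ xs a + Φ xs (a + y)) + (Φ xs (a + x) + Φ xs (a + y + x))
    ≡⟨ +-interchange (Φ xs a) _ _ _ ⟩
  (Φ xs a + Φ xs (a + x)) + (Φ xs (a + y) + Φ xs (a + y + x))
    ≡⟨ cong₂ _+_ (cong₂ _+_ (IH a) (IH (a + x))) (cong₂ _+_ (IH (a + y)) (IH (a + y + x))) ⟩
  (Φ ys a + Φ ys (a + x)) + (Φ ys (a + y) + Φ ys (a + y + x))
    ≡⟨ sym (trans (sublistSum-cons h y (x ∷ ys) a) (cong₂ _+_ (sublistSum-cons h x ys a) (sublistSum-cons h x ys (a + y)))) ⟩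
  sublistSum h (y ∷ x ∷ ys) a ∎
  where
  open ≡-Reasoning
  Φ : List ℕ → ℕ → ℕ
  Φ = sublistSum h
  IH : ∀ a → Φ xs a ≡ Φ ys a
  IH = sublistSum-↭ h p
  x+y≡y+x : ∀ a → a + x + y ≡ a + y + x
  x+y≡y+x a = trans (+-assoc a x y) (trans (cong (_+_ a) (+-comm x y)) (sym (+-assoc a y x)))
sublistSum-↭ h (↭.trans p q) a = trans (sublistSum-↭ h p a) (sublistSum-↭ h q a)

module _ (h : ℕ → ℕ) {k : ℕ} (vanishes : ∀ w → k < w → h w ≡ 0) where

  sublistSum-above : ∀ xs a → k < a → sublistSum h xs a ≡ 0
  sublistSum-above []       a k<a = cong (_+ 0) (vanishes (a + 0) (≤-trans k<a (m≤m+n a 0)))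
  sublistSum-above (x ∷ xs) a k<a = begin
    sublistSum h (x ∷ xs) a                     ≡⟨ sublistSum-cons h x xs a ⟩
    sublistSum h xs a + sublistSum h xs (a + x) ≡⟨ cong₂ _+_ (sublistSum-above xs a k<a)
                                                            (sublistSum-above xs (a + x) (≤-trans k<a (m≤m+n a x))) ⟩
    0                                           ∎
    where open ≡-Reasoning

  sublistSum-filter : ∀ xs a → 1 ≤ a → sublistSum h xs a ≡ sublistSum h (filter (_<? k) xs) a
  sublistSum-filter []       a 1≤a = refl
  sublistSum-filter (x ∷ xs) a 1≤a with x <? k
  ... | yes x<k = begin
    sublistSum h (x ∷ xs) a
      ≡⟨ sublistSum-cons h x xs a ⟩
    sublistSum h xs a + sublistSum h xs (a + x)
      ≡⟨ cong₂ _+_ (sublistSum-filter xs a 1≤a) (sublistSum-filter xs (a + x) (≤-trans 1≤a (m≤m+n a x))) ⟩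
    sublistSum h (filter (_<? k) xs) a + sublistSum h (filter (_<? k) xs) (a + x)
      ≡⟨ sublistSum-cons h x (filter (_<? k) xs) a ⟨
    sublistSum h (x ∷ filter (_<? k) xs) a
      ≡⟨ cong (λ ys → sublistSum h ys a) (filter-accept (_<? k) x<k) ⟨
    sublistSum h (filter (_<? k) (x ∷ xs)) a ∎
    where open ≡-Reasoning
  ... | no x≮k = begin
    sublistSum h (x ∷ xs) a
      ≡⟨ sublistSum-cons h x xs a ⟩
    sublistSum h xs a + sublistSum h xs (a + x)
      ≡⟨ cong₂ _+_ (sublistSum-filter xs a 1≤a) (sublistSum-above xs (a + x) (+-mono-≤ 1≤a (≮⇒≥ x≮k))) ⟩
    sublistSum h (filter (_<? k) xs) a + 0
      ≡⟨ +-identityʳ _ ⟩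
    sublistSum h (filter (_<? k) xs) a
      ≡⟨ cong (λ ys → sublistSum h ys a) (filter-reject (_<? k) x≮k) ⟨
    sublistSum h (filter (_<? k) (x ∷ xs)) a ∎
    where open ≡-Reasoning

sublistSum-least : ∀ h a xs → All (1 ≤_) xs → (∀ w → a < w → h w ≡ 0) → sublistSum h xs a ≡ h a
sublistSum-least h a []       _             _        = trans (+-identityʳ _) (cong h (+-identityʳ a))
sublistSum-least h a (x ∷ xs) (1≤x ∷ 1≤xs) vanishes = begin
  sublistSum h (x ∷ xs) a                      ≡⟨ sublistSum-cons h x xs a ⟩
  sublistSum h xs a + sublistSum h xs (a + x)  ≡⟨ cong₂ _+_ (sublistSum-least h a xs 1≤xs vanishes)
                                                          (sublistSum-above h vanishes xs (a + x) (m<m+n a 1≤x)) ⟩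
  h a + 0                                      ≡⟨ +-identityʳ (h a) ⟩
  h a                                          ∎
  where open ≡-Reasoning

indicator : ℕ → ℕ → ℕ
indicator k w = if ⌊ w ℕ.≟ k ⌋ then 1 else 0

indicator-self : ∀ k → indicator k k ≡ 1
indicator-self k rewrite T⇒≡true (fromWitness {a? = k ℕ.≟ k} refl) = refl

indicator-≢ : ∀ {k w} → w ≢ k → indicator k w ≡ 0
indicator-≢ {k} {w} w≢k rewrite ¬T⇒≡false {⌊ w ℕ.≟ k ⌋} (w≢k ∘ toWitness) = refl

indicator-pos : ∀ {k w} → 1 ≤ indicator k w → w ≡ k
indicator-pos {k} {w} pos with w ℕ.≟ k
... | yes w≡k = w≡k
... | no  _   = contradiction pos λ ()

indicator-vanishes : ∀ k w → k < w → indicator k w ≡ 0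
indicator-vanishes k w k<w = indicator-≢ (>⇒≢ k<w)

multiplicity : ℕ → List ℕ → ℕ
multiplicity k xs = sum (map (indicator k) xs)

multiplicity-++ : ∀ k xs ys → multiplicity k (xs ++ ys) ≡ multiplicity k xs + multiplicity k ys
multiplicity-++ k xs ys = trans (cong sum (map-++ (indicator k) xs ys)) (NatSum.big-++ (map (indicator k) xs) _)

multiplicity-∈ : ∀ k xs → 1 ≤ multiplicity k xs → k ∈ xs
multiplicity-∈ k (x ∷ xs) pos with x ℕ.≟ k
... | yes x≡k = here (sym x≡k)
... | no  _   = there (multiplicity-∈ k xs pos)

multiplicity⇒↭ : ∀ xs ys → (∀ k → multiplicity k xs ≡ multiplicity k ys) → xs ↭ ys
multiplicity⇒↭ []       []       _    = ↭.↭-refl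
multiplicity⇒↭ []       (y ∷ ys) same = contradiction (trans (same y) (cong (_+ multiplicity y ys) (indicator-self y))) λ ()
multiplicity⇒↭ (x ∷ xs) ys       same with ∈-∃++ (multiplicity-∈ x ys (subst (1 ≤_) (same x) head-counted))
  where
  head-counted : 1 ≤ multiplicity x (x ∷ xs)
  head-counted = subst (λ i → 1 ≤ i + multiplicity x xs) (sym (indicator-self x)) (s≤s z≤n)
... | ys₁ , ys₂ , refl =
  ↭.↭-trans (↭.↭-prep x (multiplicity⇒↭ xs (ys₁ ++ ys₂) same-rest)) (↭.↭-sym (shift x ys₁ ys₂))
  where
  same-rest : ∀ k → multiplicity k xs ≡ multiplicity k (ys₁ ++ ys₂)
  same-rest k = +-cancelˡ-≡ (indicator k x) _ _ (begin
    indicator k x + multiplicity k xs                          ≡⟨ same k ⟩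
    multiplicity k (ys₁ ++ x ∷ ys₂)                            ≡⟨ multiplicity-++ k ys₁ (x ∷ ys₂) ⟩
    multiplicity k ys₁ + (indicator k x + multiplicity k ys₂)  ≡⟨ +-exchange (multiplicity k ys₁) (indicator k x) (multiplicity k ys₂) ⟩
    indicator k x + (multiplicity k ys₁ + multiplicity k ys₂)  ≡⟨ cong (_+_ (indicator k x)) (multiplicity-++ k ys₁ ys₂) ⟨
    indicator k x + multiplicity k (ys₁ ++ ys₂)                ∎)
    where open ≡-Reasoning

multiplicity-filter< : ∀ {j k} xs → j < k → multiplicity j (filter (_<? k) xs) ≡ multiplicity j xs
multiplicity-filter< []       j<k = refl
multiplicity-filter< {j} {k} (x ∷ xs) j<k with x <? k
... | yes x<k rewrite filter-accept (_<? k) {xs = xs} x<k = cong (_+_ (indicator j x)) (multiplicity-filter< xs j<k)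
... | no  x≮k rewrite filter-reject (_<? k) {xs = xs} x≮k = trans (multiplicity-filter< xs j<k)
                      (sym (cong (_+ _) (indicator-≢ λ x≡j → x≮k (subst (_< k) (sym x≡j) j<k))))

multiplicity-filter≥ : ∀ {j k} xs → k ≤ j → multiplicity j (filter (_<? k) xs) ≡ 0
multiplicity-filter≥ []       k≤j = refl
multiplicity-filter≥ {j} {k} (x ∷ xs) k≤j with x <? k
... | yes x<k rewrite filter-accept (_<? k) {xs = xs} x<k =
  trans (cong (_+ _) (indicator-≢ λ x≡j → <-irrefl x≡j (<-≤-trans x<k k≤j))) (multiplicity-filter≥ xs k≤j)
... | no  x≮k rewrite filter-reject (_<? k) {xs = xs} x≮k = multiplicity-filter≥ xs k≤j

filter<-↭ : ∀ k xs ys → (∀ j → j < k → multiplicity j xs ≡ multiplicity j ys) → filter (_<? k) xs ↭ filter (_<? k) ys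
filter<-↭ k xs ys same = multiplicity⇒↭ _ _ λ j → case j <? k of λ where
  (yes j<k) → trans (multiplicity-filter< xs j<k) (trans (same j j<k) (sym (multiplicity-filter< ys j<k)))
  (no  j≮k) → trans (multiplicity-filter≥ xs (≮⇒≥ j≮k)) (sym (multiplicity-filter≥ ys (≮⇒≥ j≮k)))

sum-unselected : ∀ h ws →
  2 * sum (map (λ bs → unselected h bs ws) (bools (length ws))) ≡ 2 ^ length ws * sum (map h ws)
sum-unselected h []       = refl
sum-unselected h (x ∷ xs) = begin
  2 * sum (map U′ (map (false ∷_) B ++ map (true ∷_) B))
    ≡⟨ cong (2 *_) (trans (cong sum (map-++ U′ (map (false ∷_) B) _)) (NatSum.big-++ (map U′ (map (false ∷_) B)) _)) ⟩
  2 * (sum (map U′ (map (false ∷_) B)) + sum (map U′ (map (true ∷_) B)))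
    ≡⟨ cong (2 *_) (cong₂ _+_ (trans (cong sum (sym (map-∘ B))) (NatSum.big-∙ (λ _ → h x) U B))
                              (cong sum (sym (map-∘ B)))) ⟩
  2 * (sum (map (λ _ → h x) B) + ΣU + ΣU)
    ≡⟨ cong (λ t → 2 * (t + ΣU + ΣU)) (trans (sum-const (h x) B) (cong (_* h x) (length-bools (length xs)))) ⟩
  2 * (2 ^ length xs * h x + ΣU + ΣU)
    ≡⟨ regroup (2 ^ length xs) (h x) ΣU ⟩
  2 * (2 ^ length xs * h x) + 2 * (2 * ΣU)
    ≡⟨ cong (λ t → 2 * (2 ^ length xs * h x) + 2 * t) (sum-unselected h xs) ⟩
  2 * (2 ^ length xs * h x) + 2 * (2 ^ length xs * sum (map h xs))
    ≡⟨ factor (2 ^ length xs) (h x) (sum (map h xs)) ⟩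
  2 ^ length (x ∷ xs) * sum (map h (x ∷ xs)) ∎
  where
  open ≡-Reasoning
  B : List (List Bool)
  B = bools (length xs)
  U U′ : List Bool → ℕ
  U bs = unselected h bs xs
  U′ bs = unselected h bs (x ∷ xs)
  ΣU : ℕ
  ΣU = sum (map U B)
  regroup : ∀ p a u → 2 * (p * a + u + u) ≡ 2 * (p * a) + 2 * (2 * u)
  regroup = solve-∀ℕ
  factor : ∀ p a s → 2 * (p * a) + 2 * (p * s) ≡ 2 * p * (a + s)
  factor = solve-∀ℕ

starSum-split : ∀ γ ws h → 2 * starSum γ ws h ≡ 2 ^ length ws * sum (map h ws) + 2 * sublistSum h ws γ
starSum-split γ ws h = begin
  2 * sum (map (λ bs → h (γ + sum (sel bs ws)) + unselected h bs ws) B)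
    ≡⟨ cong (2 *_) (NatSum.big-∙ (λ bs → h (γ + sum (sel bs ws))) (λ bs → unselected h bs ws) B) ⟩
  2 * (sum (map (λ bs → h (γ + sum (sel bs ws))) B) + sum (map (λ bs → unselected h bs ws) B))
    ≡⟨ cong (λ t → 2 * (t + sum (map (λ bs → unselected h bs ws) B))) sublists-as-selections ⟩
  2 * (sublistSum h ws γ + sum (map (λ bs → unselected h bs ws) B))
    ≡⟨ trans (*-distribˡ-+ 2 (sublistSum h ws γ) _) (+-comm (2 * sublistSum h ws γ) _) ⟩
  2 * sum (map (λ bs → unselected h bs ws) B) + 2 * sublistSum h ws γ
    ≡⟨ cong (_+ 2 * sublistSum h ws γ) (sum-unselected h ws) ⟩
  2 ^ length ws * sum (map h ws) + 2 * sublistSum h ws γ ∎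
  where
  open ≡-Reasoning
  B : List (List Bool)
  B = bools (length ws)
  sublists-as-selections : sum (map (λ bs → h (γ + sum (sel bs ws))) B) ≡ sublistSum h ws γ
  sublists-as-selections =
    sym (cong sum (trans (cong (map (λ S → h (γ + sum S))) (sublists-sel ws)) (sym (map-∘ B))))

starSum-singleton : ∀ γ x h → starSum γ (x ∷ []) h ≡ h γ + h x + h (γ + x)
starSum-singleton γ x h rewrite +-identityʳ γ | +-identityʳ x = regroup (h γ) (h x) (h (γ + x))
  where
  regroup : ∀ a b c → a + (b + 0) + (c + 0 + 0) ≡ a + b + c
  regroup = solve-∀ℕ

2^[2+k]*a+2≢2^[2+k]*b : ∀ k a b → 2 ^ suc (suc k) * a + 2 * 1 ≢ 2 ^ suc (suc k) * b + 2 * 0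
2^[2+k]*a+2≢2^[2+k]*b k a b eq = even≢odd (q * b) (q * a) (sym (*-cancelˡ-≡ _ _ 2 (begin
  2 * suc (2 * (q * a))    ≡⟨ lhs q a ⟩
  2 * (2 * q) * a + 2 * 1  ≡⟨ eq ⟩
  2 * (2 * q) * b + 2 * 0  ≡⟨ rhs q b ⟩
  2 * (2 * (q * b))        ∎)))
  where
  open ≡-Reasoning
  q : ℕ
  q = 2 ^ k
  lhs : ∀ q a → 2 * suc (2 * (q * a)) ≡ 2 * (2 * q) * a + 2 * 1
  lhs = solve-∀ℕ
  rhs : ∀ q b → 2 * (2 * q) * b + 2 * 0 ≡ 2 * (2 * (q * b))
  rhs = solve-∀ℕ

equal-centres : ∀ γ ws ws' → 1 ≤ γ → length ws ≡ length ws' →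
  (∀ h → starSum γ ws h ≡ starSum γ ws' h) → ws ↭ ws'
equal-centres γ ws ws' 1≤γ same-length same = multiplicity⇒↭ ws ws' (<-rec _ same-multiplicity)
  where
  same-multiplicity : ∀ k → (∀ {j} → j < k → multiplicity j ws ≡ multiplicity j ws') →
                      multiplicity k ws ≡ multiplicity k ws'
  same-multiplicity k below = *-cancelˡ-≡ _ _ (2 ^ length ws) {{m^n≢0 2 (length ws)}} (+-cancelʳ-≡ _ _ _ (begin
    2 ^ length ws * multiplicity k ws + 2 * Φ ws    ≡⟨ starSum-split γ ws (indicator k) ⟨
    2 * starSum γ ws (indicator k)                  ≡⟨ cong (2 *_) (same (indicator k)) ⟩
    2 * starSum γ ws' (indicator k)                 ≡⟨ starSum-split γ ws' (indicator k) ⟩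
    2 ^ length ws' * multiplicity k ws' + 2 * Φ ws' ≡⟨ cong₂ (λ l t → 2 ^ l * multiplicity k ws' + 2 * t) (sym same-length) (sym small-sums) ⟩
    2 ^ length ws * multiplicity k ws' + 2 * Φ ws   ∎))
    where
    open ≡-Reasoning
    Φ : List ℕ → ℕ
    Φ xs = sublistSum (indicator k) xs γ
    small-sums : Φ ws ≡ Φ ws'
    small-sums = begin
      Φ ws                      ≡⟨ sublistSum-filter (indicator k) (indicator-vanishes k) ws γ 1≤γ ⟩
      Φ (filter (_<? k) ws)     ≡⟨ sublistSum-↭ (indicator k) (filter<-↭ k ws ws' λ _ → below) γ ⟩
      Φ (filter (_<? k) ws')    ≡⟨ sublistSum-filter (indicator k) (indicator-vanishes k) ws' γ 1≤γ ⟨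
      Φ ws'                     ∎

single-leaves : ∀ γ γ' x x' → γ < γ' →
  (∀ h → starSum γ (x ∷ []) h ≡ starSum γ' (x' ∷ []) h) → x ≡ γ' × x' ≡ γ
single-leaves γ γ' x x' γ<γ' same = x≡γ' , x'≡γ
  where
  values : ∀ h → h γ + h x + h (γ + x) ≡ h γ' + h x' + h (γ' + x')
  values h = trans (sym (starSum-singleton γ x h)) (trans (same h) (starSum-singleton γ' x' h))
  total : γ + x ≡ γ' + x'
  total = *-cancelˡ-≡ _ _ 2 (begin
    2 * (γ + x)                 ≡⟨ regroup γ x ⟩
    γ + x + (γ + x)             ≡⟨ values id ⟩
    γ' + x' + (γ' + x')         ≡⟨ regroup γ' x' ⟨
    2 * (γ' + x')               ∎)
    where
    open ≡-Reasoning
    regroup : ∀ a b → 2 * (a + b) ≡ a + b + (a + b)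
    regroup = solve-∀ℕ
  x'≡γ : x' ≡ γ
  x'≡γ = indicator-pos (≤-trans (s≤s z≤n) (≤-reflexive (+-cancelʳ-≡ (indicator γ (γ + x)) (1 + indicator γ x) (indicator γ x') (begin
    1 + indicator γ x + indicator γ (γ + x)               ≡⟨ cong (λ i → i + indicator γ x + indicator γ (γ + x)) (indicator-self γ) ⟨
    indicator γ γ + indicator γ x + indicator γ (γ + x)     ≡⟨ values (indicator γ) ⟩
    indicator γ γ' + indicator γ x' + indicator γ (γ' + x') ≡⟨ cong₂ (λ i t → i + indicator γ x' + indicator γ t) (indicator-≢ (>⇒≢ γ<γ')) (sym total) ⟩
    0 + indicator γ x' + indicator γ (γ + x)   ∎))))
    where open ≡-Reasoning
  x≡γ' : x ≡ γ'
  x≡γ' = +-cancelˡ-≡ γ _ _ (trans total (trans (cong (_+_ γ') x'≡γ) (+-comm γ' γ)))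

centre-count : ∀ γ γ' ws ws' → γ < γ' → All (1 ≤_) ws → length ws ≡ length ws' →
  (∀ h → starSum γ ws h ≡ starSum γ' ws' h) →
  2 ^ length ws * multiplicity γ ws + 2 * 1 ≡ 2 ^ length ws * multiplicity γ ws' + 2 * 0
centre-count γ γ' ws ws' γ<γ' ws≥1 same-length same = begin
  2 ^ length ws * multiplicity γ ws + 2 * 1
    ≡⟨ cong (λ t → 2 ^ length ws * multiplicity γ ws + 2 * t)
            (trans (sublistSum-least (indicator γ) γ ws ws≥1 (indicator-vanishes γ)) (indicator-self γ)) ⟨
  2 ^ length ws * multiplicity γ ws + 2 * sublistSum (indicator γ) ws γ
    ≡⟨ starSum-split γ ws (indicator γ) ⟨
  2 * starSum γ ws (indicator γ)
    ≡⟨ cong (2 *_) (same (indicator γ)) ⟩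
  2 * starSum γ' ws' (indicator γ)
    ≡⟨ starSum-split γ' ws' (indicator γ) ⟩
  2 ^ length ws' * multiplicity γ ws' + 2 * sublistSum (indicator γ) ws' γ'
    ≡⟨ cong₂ (λ l t → 2 ^ l * multiplicity γ ws' + 2 * t) (sym same-length)
             (sublistSum-above (indicator γ) (indicator-vanishes γ) ws' γ' γ<γ') ⟩
  2 ^ length ws * multiplicity γ ws' + 2 * 0 ∎
  where open ≡-Reasoning

different-centres : ∀ γ γ' ws ws' → γ < γ' → All (1 ≤_) ws → length ws ≡ length ws' →
  (∀ h → starSum γ ws h ≡ starSum γ' ws' h) → ws ≡ γ' ∷ [] × ws' ≡ γ ∷ []
different-centres γ γ' ws ws' γ<γ' ws≥1 same-length same =
  by-length ws ws' same-length same (centre-count γ γ' ws ws' γ<γ' ws≥1 same-length same)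
  where
  by-length : ∀ ws ws' → length ws ≡ length ws' → (∀ h → starSum γ ws h ≡ starSum γ' ws' h) →
    2 ^ length ws * multiplicity γ ws + 2 * 1 ≡ 2 ^ length ws * multiplicity γ ws' + 2 * 0 →
    ws ≡ γ' ∷ [] × ws' ≡ γ ∷ []
  by-length []            []            _  _    count = contradiction count λ ()
  by-length (x ∷ [])      (x' ∷ [])     _  same _     =
    let x≡γ' , x'≡γ = single-leaves γ γ' x x' γ<γ' same in cong (_∷ []) x≡γ' , cong (_∷ []) x'≡γ
  by-length (_ ∷ _ ∷ ws)  (_ ∷ _ ∷ _)   _  _    count = contradiction count (2^[2+k]*a+2≢2^[2+k]*b (length ws) _ _)
  by-length []            (_ ∷ _)       ()
  by-length (_ ∷ _)       []            ()
  by-length (_ ∷ [])      (_ ∷ _ ∷ _)   ()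
  by-length (_ ∷ _ ∷ _)   (_ ∷ [])      ()

recover-star : ∀ γ γ' ws ws' → 1 ≤ γ → All (1 ≤_) ws → All (1 ≤_) ws' → length ws ≡ length ws' →
  (∀ h → starSum γ ws h ≡ starSum γ' ws' h) →
  (γ ≡ γ' × ws ↭ ws') ⊎ (ws ≡ γ' ∷ [] × ws' ≡ γ ∷ [])
recover-star γ γ' ws ws' 1≤γ ws≥1 ws'≥1 same-length same with <-cmp γ γ'
... | tri< γ<γ' _ _ = inj₂ (different-centres γ γ' ws ws' γ<γ' ws≥1 same-length same)
... | tri≈ _ refl _ = inj₁ (refl , equal-centres γ ws ws' 1≤γ same-length same)
... | tri> _ _ γ'<γ = inj₂ (Product.swap (different-centres γ' γ ws' ws γ'<γ ws'≥1 (sym same-length) (sym ∘ same)))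

tabulate-punchIn : ∀ {n} {X : Set} (g : Fin (suc n) → X) j → tabulate g ↭ g j ∷ tabulate (g ∘ punchIn j)
tabulate-punchIn         g fzero    = ↭.↭-refl
tabulate-punchIn {suc n} g (fsuc j) =
  ↭.↭-trans (↭.↭-prep (g fzero) (tabulate-punchIn (g ∘ fsuc) j)) (↭.↭-swap (g fzero) (g (fsuc j)) ↭.↭-refl)

tabulate-↭⇒↭ᵥ : ∀ {n n'} {X : Set} (f : Fin n → X) (g : Fin n' → X) → tabulate f ↭ tabulate g → g ↭ᵥ f
tabulate-↭⇒↭ᵥ {zero}  {zero}   f g _ = Perm.id , λ ()
tabulate-↭⇒↭ᵥ {zero}  {suc n'} f g p = contradiction (↭-length p) λ ()
tabulate-↭⇒↭ᵥ {suc n} {zero}   f g p = contradiction (↭-length p) λ ()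
tabulate-↭⇒↭ᵥ {suc n} {suc n'} f g p with ∈-tabulate⁻ (∈-resp-↭ p (here refl))
... | j , f₀≡gj = Perm.insert fzero j ρ , λ where
    fzero    → sym f₀≡gj
    (fsuc i) → trans (cong g (Perm.insert-punchIn fzero j ρ i)) (g-ρ i)
  where
  rest : tabulate (f ∘ fsuc) ↭ tabulate (g ∘ punchIn j)
  rest = drop-∷ (↭.↭-trans (subst (λ a → a ∷ tabulate (f ∘ fsuc) ↭ tabulate g) f₀≡gj p) (tabulate-punchIn g j))
  matching : (g ∘ punchIn j) ↭ᵥ (f ∘ fsuc)
  matching = tabulate-↭⇒↭ᵥ (f ∘ fsuc) (g ∘ punchIn j) rest
  ρ : Perm.Permutation n n'
  ρ = proj₁ matching
  g-ρ : ∀ i → g (punchIn j (ρ ⟨$⟩ʳ i)) ≡ f (fsuc i)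
  g-ρ = proj₂ matching

2^-injective : ∀ {m n} → 2 ^ m ≡ 2 ^ n → m ≡ n
2^-injective {m} {n} eq with <-cmp m n
... | tri< m<n _ _ = contradiction eq (<⇒≢ (^-monoʳ-< 2 (s≤s (s≤s z≤n)) m<n))
... | tri≈ _ m≡n _ = m≡n
... | tri> _ _ n<m = contradiction (sym eq) (<⇒≢ (^-monoʳ-< 2 (s≤s (s≤s z≤n)) n<m))

module CentredStar (T : WeightedTree) (c : Fin (size (tree T)))
                    (incident : All (λ e → proj₁ e ≡ c ⊎ proj₂ e ≡ c) (edges (tree T))) where

  open Star (tree T) (isTree T) c incident public

  leafWeights : List ℕ
  leafWeights = map (weight T) leaves

  length-leafWeights : length leafWeights ≡ length (edges (tree T))
  length-leafWeights = trans (length-map (weight T) leaves) (length-map (leafOf c) (edges (tree T)))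

  M-star : ∀ z → Poly.M dualRing (tree T) (markω T) z ≡ starM (weight T c) leafWeights z
  M-star z = begin
    DualSum.big (map term (sublists E))
      ≡⟨ cong (DualSum.big ∘ map term) (sublists-sel E) ⟩
    DualSum.big (map term (map (λ bs → sel bs E) (bools (length E))))
      ≡⟨ cong DualSum.big (sym (map-∘ (bools (length E)))) ⟩
    DualSum.big (map (λ bs → term (sel bs E)) (bools (length E)))
      ≡⟨ cong DualSum.big (map-cong-local (All.map (λ {bs} length-bs →
            StarSubgraph.components-star (tree T) (isTree T) c incident bs length-bs (weight T) z)
            (bools-length (length E)))) ⟩
    DualSum.big (map (starTerm (weight T c) leafWeights z) (bools (length E)))
      ≡⟨ cong (λ k → DualSum.big (map (starTerm (weight T c) leafWeights z) (bools k))) (sym length-leafWeights) ⟩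
    starM (weight T c) leafWeights z ∎
    where
    open ≡-Reasoning
    E : List (Edge (size (tree T)))
    E = edges (tree T)
    term : List (Edge (size (tree T))) → Dual
    term A = let open Components A in
      DualProduct.big (map (λ r → z (proj₁ (compMark (markω T) r)) (proj₂ (compMark (markω T) r))) roots)

  D-probe : StrictlyWeighted T → ∀ h →
    Poly.D dualRing (tree T) (markω T) (probe h) ≡ + 2 ^ length leafWeights +ε + starSum (weight T c) leafWeights h
  D-probe strict h = trans (M-star (Poly.Dsub dualRing (probe h)))
    (starM-probe h (weight T c) leafWeights (strict c) (All.map⁺ (All.universal strict leaves)))

  leafWeights-positive : All (1 ≤_) leafWeights
  leafWeights-positive = All.map⁺ (All.universal (weight-pos T) leaves)

  key : Fin (size (tree T)) → Maybe ℕ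
  key v = if ⌊ v ≟ c ⌋ then nothing else just (weight T v)

  key-centre : key c ≡ nothing
  key-centre rewrite T⇒≡true (fromWitness {a? = c ≟ c} refl) = refl

  key-leaf : ∀ {v} → v ≢ c → key v ≡ just (weight T v)
  key-leaf {v} v≢c rewrite ¬T⇒≡false {⌊ v ≟ c ⌋} (v≢c ∘ toWitness) = refl

  key≡nothing : ∀ {v} → key v ≡ nothing → v ≡ c
  key≡nothing {v} eq with v ≟ c
  ... | yes v≡c = v≡c
  ... | no  _   = contradiction eq λ ()

  keys↭ : tabulate key ↭ nothing ∷ map just leafWeights
  keys↭ = begin
    tabulate key                          ≡⟨ map-tabulate id key ⟨
    map key (allFin (size (tree T)))      ↭⟨ map⁺ key (↭-sym centre∷leaves↭) ⟩
    key c ∷ map key leaves                ≡⟨ cong₂ _∷_ key-centre (map-cong-local (All.map (λ c≢v → key-leaf (c≢v ∘ sym)) centre∉leaves)) ⟩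
    nothing ∷ map (just ∘ weight T) leaves ≡⟨ cong (nothing ∷_) (map-∘ leaves) ⟩
    nothing ∷ map just leafWeights        ∎
    where open ↭.PermutationReasoning

spoke-reversed : ∀ {n} {c : Fin n} {e} → Spoke c e →
  (proj₁ e ≡ leafOf c e ⊎ proj₂ e ≡ leafOf c e) × leafOf (leafOf c e) e ≡ c
spoke-reversed {c = c} {e} (inj₁ (e₁≡c , e₂≡l) , l≢c)
  rewrite ¬T⇒≡false {⌊ proj₁ e ≟ leafOf c e ⌋} (λ e₁≡l → l≢c (trans (sym (toWitness e₁≡l)) e₁≡c))
  = inj₂ e₂≡l , e₁≡c
spoke-reversed {c = c} {e} (inj₂ (e₁≡l , e₂≡c) , _)
  rewrite T⇒≡true (fromWitness {a? = proj₁ e ≟ leafOf c e} e₁≡l)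
  = inj₁ e₁≡l , e₂≡c

map-≡[_] : ∀ {A B : Set} {f : A → B} xs {y} → map f xs ≡ y ∷ [] → ∃ λ x → xs ≡ x ∷ [] × f x ≡ y
map-≡[ x ∷ [] ] refl = x , refl , refl

single-leaf-recentre : ∀ T {c} (incident : All (λ e → proj₁ e ≡ c ⊎ proj₂ e ≡ c) (edges (tree T))) {x} →
  CentredStar.leafWeights T c incident ≡ x ∷ [] →
  Σ (Fin (size (tree T))) λ l → Σ (All (λ e → proj₁ e ≡ l ⊎ proj₂ e ≡ l) (edges (tree T))) λ incident' →
    weight T l ≡ x × CentredStar.leafWeights T l incident' ≡ weight T c ∷ []
single-leaf-recentre T {c} incident ws≡[x]
  with e , E≡[e] , wl≡x ← map-≡[ edges (tree T) ] (trans (map-∘ (edges (tree T))) ws≡[x]) =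
  leafOf c e , subst (All (λ e′ → proj₁ e′ ≡ leafOf c e ⊎ proj₂ e′ ≡ leafOf c e)) (sym E≡[e]) (proj₁ reversed ∷ []) , wl≡x ,
  trans (cong (λ es → map (weight T) (map (leafOf (leafOf c e)) es)) E≡[e]) (cong (λ v → weight T v ∷ []) (proj₂ reversed))
  where
  reversed : (proj₁ e ≡ leafOf c e ⊎ proj₂ e ≡ leafOf c e) × leafOf (leafOf c e) e ≡ c
  reversed = spoke-reversed (All.lookup (Star.spokes (tree T) (isTree T) c incident) (subst (e ∈_) (sym E≡[e]) (here refl)))

star-isomorphism : ∀ T T' {c c'}
  (incident  : All (λ e → proj₁ e ≡ c  ⊎ proj₂ e ≡ c)  (edges (tree T)))
  (incident' : All (λ e → proj₁ e ≡ c' ⊎ proj₂ e ≡ c') (edges (tree T'))) →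
  weight T c ≡ weight T' c' →
  CentredStar.leafWeights T c incident ↭ CentredStar.leafWeights T' c' incident' →
  ωIsomorphic T T'
star-isomorphism T T' {c} {c'} incident incident' centres≡ leaves↭ = ↔⇒⤖ ρ , adjacent , weights
  where
  module S  = CentredStar T c incident
  module S' = CentredStar T' c' incident'
  matching : S'.key ↭ᵥ S.key
  matching = tabulate-↭⇒↭ᵥ S.key S'.key
    (↭.↭-trans S.keys↭ (↭.↭-trans (↭.↭-prep nothing (map⁺ just leaves↭)) (↭-sym S'.keys↭)))
  ρ : Perm.Permutation (size (tree T)) (size (tree T'))
  ρ = proj₁ matching
  key-ρ : ∀ v → S'.key (ρ ⟨$⟩ʳ v) ≡ S.key v
  key-ρ = proj₂ matching
  ρ-centre : ρ ⟨$⟩ʳ c ≡ c'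
  ρ-centre = S'.key≡nothing (trans (key-ρ c) S.key-centre)
  ρ-centre⁻ : ∀ {v} → ρ ⟨$⟩ʳ v ≡ c' → v ≡ c
  ρ-centre⁻ {v} ρv≡c' = S.key≡nothing (trans (sym (key-ρ v)) (trans (cong S'.key ρv≡c') S'.key-centre))
  weights : ∀ v → weight T' (ρ ⟨$⟩ʳ v) ≡ weight T v
  weights v with v ≟ c
  ... | yes refl = trans (cong (weight T') ρ-centre) (sym centres≡)
  ... | no  v≢c  = just-injective (trans (sym (S'.key-leaf (v≢c ∘ ρ-centre⁻))) (trans (key-ρ v) (S.key-leaf v≢c)))
  forth : ∀ {u v} → (u ≡ c × v ≢ c) ⊎ (v ≡ c × u ≢ c) →
          (ρ ⟨$⟩ʳ u ≡ c' × ρ ⟨$⟩ʳ v ≢ c') ⊎ (ρ ⟨$⟩ʳ v ≡ c' × ρ ⟨$⟩ʳ u ≢ c')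
  forth = Sum.map (Product.map (λ { refl → ρ-centre }) (_∘ ρ-centre⁻)) (Product.map (λ { refl → ρ-centre }) (_∘ ρ-centre⁻))
  back : ∀ {u v} → (ρ ⟨$⟩ʳ u ≡ c' × ρ ⟨$⟩ʳ v ≢ c') ⊎ (ρ ⟨$⟩ʳ v ≡ c' × ρ ⟨$⟩ʳ u ≢ c') →
         (u ≡ c × v ≢ c) ⊎ (v ≡ c × u ≢ c)
  back = Sum.map (Product.map ρ-centre⁻ (λ ρv≢c' → λ { refl → ρv≢c' ρ-centre }))
                 (Product.map ρ-centre⁻ (λ ρu≢c' → λ { refl → ρu≢c' ρ-centre }))
  adjacent : ∀ u v → (Adj (tree T) u v → Adj (tree T') (ρ ⟨$⟩ʳ u) (ρ ⟨$⟩ʳ v))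
                   × (Adj (tree T') (ρ ⟨$⟩ʳ u) (ρ ⟨$⟩ʳ v) → Adj (tree T) u v)
  adjacent u v = (Equivalence.from S'.Adj⇔ ∘ forth ∘ Equivalence.to S.Adj⇔)
               , (Equivalence.from S.Adj⇔ ∘ back ∘ Equivalence.to S'.Adj⇔)

swapped-star-isomorphism : ∀ T T' {c c'}
  (incident  : All (λ e → proj₁ e ≡ c  ⊎ proj₂ e ≡ c)  (edges (tree T)))
  (incident' : All (λ e → proj₁ e ≡ c' ⊎ proj₂ e ≡ c') (edges (tree T'))) →
  CentredStar.leafWeights T c incident ≡ weight T' c' ∷ [] →
  CentredStar.leafWeights T' c' incident' ≡ weight T c ∷ [] →
  ωIsomorphic T T'
swapped-star-isomorphism T T' incident incident' ws≡[γ'] ws'≡[γ]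
  with l' , incident'' , wl'≡γ , ws''≡[γ'] ← single-leaf-recentre T' incident' ws'≡[γ] =
  star-isomorphism T T' incident incident'' (sym wl'≡γ) (↭.↭-reflexive (trans ws≡[γ'] (sym ws''≡[γ'])))

probes-agree : ∀ T T' {c c'}
  (incident  : All (λ e → proj₁ e ≡ c  ⊎ proj₂ e ≡ c)  (edges (tree T)))
  (incident' : All (λ e → proj₁ e ≡ c' ⊎ proj₂ e ≡ c') (edges (tree T'))) →
  StrictlyWeighted T → StrictlyWeighted T' → SameD T T' →
  let ws = CentredStar.leafWeights T c incident; ws' = CentredStar.leafWeights T' c' incident' in
  length ws ≡ length ws' × (∀ h → starSum (weight T c) ws h ≡ starSum (weight T' c') ws' h)
probes-agree T T' {c} {c'} incident incident' strict strict' sameD =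
  2^-injective (ℤ.+-injective (cong re (probed (λ _ → 0)))) , λ h → ℤ.+-injective (cong ep (probed h))
  where
  module S  = CentredStar T c incident
  module S' = CentredStar T' c' incident'
  probed : ∀ h → (+ 2 ^ length S.leafWeights +ε + starSum (weight T c) S.leafWeights h)
               ≡ (+ 2 ^ length S'.leafWeights +ε + starSum (weight T' c') S'.leafWeights h)
  probed h = trans (sym (S.D-probe strict h)) (trans (sameD dualRing (probe h)) (S'.D-probe strict' h))

theorem7p15 : (T T' : WeightedTree) →
    StrictlyWeighted T → WeightedStar T →
    StrictlyWeighted T' → WeightedStar T' →
    SameD T T' → ωIsomorphic T T'
theorem7p15 T T' strict (_ , c , incident) strict' (_ , c' , incident') sameD =
  Sum.[ Product.uncurry (star-isomorphism T T' incident incident')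
      , Product.uncurry (swapped-star-isomorphism T T' incident incident') ]
    (Product.uncurry
       (recover-star (weight T c) (weight T' c') S.leafWeights S'.leafWeights
                     (weight-pos T c) S.leafWeights-positive S'.leafWeights-positive)
       (probes-agree T T' incident incident' strict strict' sameD))
  where
  module S  = CentredStar T c incident
  module S' = CentredStar T' c' incident'
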